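{- Let $T$ be a tree, let $v_1 \neq v_2$ be leaves of $T$, and let $v_1 x_1 x_2 \cdots x_n v_2$ be the path in $T$ between them. Let $1 \le k \le n-1$. If $C_{\leq k-1} < C_{\geq k+2}$ and $C_k > C_{k+1}$, then the tree $S$ obtained from $T$ by interchanging $X_k$ and $X_{k+1}$ (equivalently, deleting the edges $x_{k-1}x_k$ and $x_{k+1}x_{k+2}$ and adding the edges $x_{k-1}x_{k+1}$ and $x_k x_{k+2}$) satisfies $f(S) > f(T)$.
   Context: A subtree of a tree is a nonempty connected subgraph; $f(T)$ is the number of subtrees of $T$, and for a subgraph $X$ of $T$ and a vertex $u$ of $X$, $f_u(X)$ denotes the number of subtrees of $X$ containing $u$. Write $x_0 := v_1$ and $x_{n+1} := v_2$. After deleting all edges of the path $v_1x_1\cdots x_nv_2$, let $X_i$ be the connected component containing $x_i$ ($1\le i\le n$). For $0 \le i \le n$, let $X_{\leq i}$ be the component containing $x_i$ in $T - x_i x_{i+1}$, and for $1 \le j \le n+1$ let $X_{\geq j}$ be the component containing $x_j$ in $T - x_{j-1}x_j$ (so $X_{\le 0}=\{v_1\}$ and $X_{\ge n+1}=\{v_2\}$). Set $C_k := f_{x_k}(X_k)$, $C_{\leq k} := f_{x_k}(X_{\leq k})$, $C_{\geq k} := f_{x_k}(X_{\geq k})$; in particular $C_{\le 0} = C_{\ge n+1} = 1$. -}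

module Defs where

open import Data.Nat using (ℕ; zero; suc; _+_; _∸_)
open import Data.Bool using (Bool; true; false; _∧_; _∨_; not; if_then_else_)
open import Data.Fin using (Fin; _≟_)
open import Data.Product using (_×_; _,_; proj₁; proj₂)
open import Data.List using (List; []; _∷_; [_]; _++_; map; length; filterᵇ; allFin; upTo; foldr)
open import Data.Bool.ListAction using (all; any)
open import Data.Vec using (Vec; []; _∷_; lookup; tabulate)
open import Relation.Nullary.Decidable using (⌊_⌋)
open import Relation.Binary.PropositionalEquality using (_≡_)

-- Graphs on the vertex set Fin N, given by a list of (undirected) edges.

Edge : ℕ → Set
Edge N = Fin N × Fin N

Graph : ℕ → Set
Graph N = List (Edge N)

_==_ : ∀ {N} → Fin N → Fin N → Bool
i == j = ⌊ i ≟ j ⌋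

sameEdge : ∀ {N} → Edge N → Fin N → Fin N → Bool
sameEdge (a , b) u v = (a == u ∧ b == v) ∨ (a == v ∧ b == u)

adj : ∀ {N} → Graph N → Fin N → Fin N → Bool
adj E u v = any (λ e → sameEdge e u v) E

removeEdge : ∀ {N} → Fin N → Fin N → Graph N → Graph N
removeEdge u v = filterᵇ (λ e → not (sameEdge e u v))

deg : ∀ {N} → Graph N → Fin N → ℕ
deg E v = length (filterᵇ (λ e → proj₁ e == v ∨ proj₂ e == v) E)

data Reach {N} (E : Graph N) : Fin N → Fin N → Set where
  here : ∀ {u} → Reach E u u
  step : ∀ {u w v} → adj E u w ≡ true → Reach E w v → Reach E u v

IsTree : (N : ℕ) → Graph N → Set
IsTree N E = (length E + 1 ≡ N) × (∀ u v → Reach E u v)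

IsLeaf : ∀ {N} → Graph N → Fin N → Set
IsLeaf E v = deg E v ≡ 1

VSet : ℕ → Set
VSet N = Vec Bool N

allSubsets : (N : ℕ) → List (VSet N)
allSubsets zero = [ [] ]
allSubsets (suc N) = map (true ∷_) (allSubsets N) ++ map (false ∷_) (allSubsets N)

_⊆ᵇ_ : ∀ {N} → VSet N → VSet N → Bool
_⊆ᵇ_ {N} A B = all (λ v → not (lookup A v) ∨ lookup B v) (allFin N)

full : ∀ {N} → VSet N
full = tabulate (λ _ → true)

iter : ∀ {A : Set} → ℕ → (A → A) → A → A
iter zero f a = a
iter (suc n) f a = f (iter n f a)

grow : ∀ {N} → Graph N → VSet N → VSet N → VSet N
grow {N} E S R = tabulate (λ v → lookup R v ∨
  (lookup S v ∧ any (λ u → lookup R u ∧ adj E u v) (allFin N)))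

-- the set of vertices reachable from u by walks in E staying inside S
-- (N growth steps suffice on N vertices)
reachIn : ∀ {N} → Graph N → VSet N → Fin N → VSet N
reachIn {N} E S u = iter N (grow E S) (tabulate (λ v → (v == u) ∧ lookup S u))

component : ∀ {N} → Graph N → Fin N → VSet N
component E u = reachIn E full u

connectedAtᵇ : ∀ {N} → Graph N → VSet N → Fin N → Bool
connectedAtᵇ E S u = lookup S u ∧ (S ⊆ᵇ reachIn E S u)

isSubtreeᵇ : ∀ {N} → Graph N → VSet N → Bool
isSubtreeᵇ {N} E S = any (λ u → connectedAtᵇ E S u) (allFin N)

count : ∀ {A : Set} → (A → Bool) → List A → ℕ
count p xs = length (filterᵇ p xs)

f : ∀ {N} → Graph N → ℕ
f {N} E = count (isSubtreeᵇ E) (allSubsets N)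

fAt : ∀ {N} → Graph N → VSet N → Fin N → ℕ
fAt {N} E X u = count (λ S → (S ⊆ᵇ X) ∧ connectedAtᵇ E S u) (allSubsets N)

-- The path v₁ = x 0, x 1, ..., x n, x (n+1) = v₂ (indexed by ℕ; only
-- indices 0..n+1 matter).

IsPath : ∀ {N} → Graph N → (n : ℕ) → (ℕ → Fin N) → Set
IsPath E n x =
  (∀ i → i Data.Nat.≤ n → adj E (x i) (x (suc i)) ≡ true) ×
  (∀ i j → i Data.Nat.≤ suc n → j Data.Nat.≤ suc n → x i ≡ x j → i ≡ j)

removePath : ∀ {N} → Graph N → (n : ℕ) → (ℕ → Fin N) → Graph N
removePath E n x = foldr (λ i G → removeEdge (x i) (x (suc i)) G) E (upTo (suc n))

Cmid : ∀ {N} → Graph N → ℕ → (ℕ → Fin N) → ℕ → ℕ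
Cmid E n x k = let G = removePath E n x in fAt G (component G (x k)) (x k)

Cle : ∀ {N} → Graph N → (ℕ → Fin N) → ℕ → ℕ
Cle E x i = let G = removeEdge (x i) (x (suc i)) E in fAt G (component G (x i)) (x i)

Cge : ∀ {N} → Graph N → (ℕ → Fin N) → ℕ → ℕ
Cge E x j = let G = removeEdge (x (j ∸ 1)) (x j) E in fAt G (component G (x j)) (x j)

swapTree : ∀ {N} → Graph N → (ℕ → Fin N) → ℕ → Graph N
swapTree E x k =
  (x (k ∸ 1) , x (suc k)) ∷ (x k , x (suc (suc k))) ∷
  removeEdge (x (k ∸ 1)) (x k) (removeEdge (x (suc k)) (x (suc (suc k))) E)

-- Cutting T at the path edges x_{k-1}x_k, x_k x_{k+1}, x_{k+1}x_{k+2} leaves four branches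
-- X_{≤k-1}, X_k, X_{k+1}, X_{≥k+2}; T joins them in the order 0 – 1 – 2 – 3 and S in the order
-- 0 – 2 – 1 – 3. If two disjoint vertex sets A, B are joined by exactly one edge ab, a subtree of
-- A ∪ B lies in A, lies in B, or is glued from a subtree of A at a and one of B at b, so
--   f(A ∪ B) = f(A) + f(B) + f_a(A) f_b(B)   and   f_b(A ∪ B) = f_b(B) + f_a(A) f_b(B).
-- Three such splittings express f(T) and f(S) through the branches, and the two expressions differ
-- by f(S) − f(T) = (C_{≥k+2} − C_{≤k-1}) (C_k − C_{k+1}), which the hypotheses make positive.

module Submission where

open import Defs
open import Data.Nat using (ℕ; zero; suc; _+_; _*_; _∸_; _≤_; _<_; _>_; z≤n; s≤s; _<ᵇ_)
open import Data.Nat.Properties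
  using ( ≤-refl; ≤-trans; ≤-reflexive; ≤-pred; <-irrefl; <-trans; ≤-<-trans; <-≤-trans; <-cmp; ≮⇒≥; <⇒≤; <⇒≢; >⇒≢
        ; n≤1+n; n<1+n; m≤n⇒m≤1+n; m<n⇒m<1+n; m≤n⇒m<n∨m≡n; m≢1+n+m; m≤n⇒∃[o]m+o≡n; m<m+n; <ᵇ⇒<; <⇒<ᵇ
        ; +-suc; +-comm; +-assoc; +-identityʳ; +-monoʳ-≤; +-monoˡ-≤; *-distribʳ-+; *-distribˡ-+; module ≤-Reasoning )
open import Data.Nat.Tactic.RingSolver using (solve-∀)
open import Data.Bool using (Bool; true; false; _∧_; _∨_; not; if_then_else_; T)
import Data.Bool.Properties as Bool
open import Data.Fin using (Fin; _≟_; toℕ; #_) renaming (zero to fzero; suc to fsuc)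
open import Data.Fin.Properties using (toℕ-injective; suc-injective)
import Data.Fin.Subset as Subset
open import Data.Fin.Subset using (_∩_; _∪_)
open import Data.Fin.Subset.Properties using (∣p∣≤n; p⊂q⇒∣p∣<∣q∣; x∈p⇒∣p-x∣<∣p∣)
open import Data.Product using (_×_; _,_; proj₁; proj₂; ∃)
open import Data.Sum using (_⊎_; inj₁; inj₂)
import Data.Sum as Sum
open import Data.List using (List; []; _∷_; allFin; filterᵇ; length; _++_; map; foldr; upTo)
import Data.List as List
open import Data.List.Properties using (filter-++; length-++; filter-notAll; filter-≐)
open import Data.Bool.ListAction using (all; any)
import Data.List.Relation.Unary.All as All
open import Data.List.Relation.Unary.All.Properties using (all⁺; all⁻)
import Data.List.Relation.Unary.Any as Any
open import Data.List.Relation.Unary.Any.Properties using (any⁺; any⁻)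
open import Data.List.Membership.Propositional using (lose) renaming (_∈_ to _∈ₗ_)
open import Data.List.Membership.Propositional.Properties using (∈-allFin; ∈-upTo⁺; ∈-upTo⁻)
open import Data.Vec using (Vec; []; _∷_; lookup; tabulate)
open import Data.Vec.Properties using (lookup∘tabulate; tabulate∘lookup; tabulate-cong; lookup-zipWith; lookup⇒[]=; []=⇒lookup)
open import Function using (_∘_; _∘′_; id; Equivalence)
open import Relation.Nullary using (¬_; yes; no)
open import Relation.Binary using (tri<; tri≈; tri>)
open import Data.Empty using (⊥; ⊥-elim)
open import Relation.Binary.PropositionalEquality

private
  variable
    A B : Set

∧-elimˡ : ∀ {a b} → a ∧ b ≡ true → a ≡ true
∧-elimˡ {true} _ = refl

∧-elimʳ : ∀ {a b} → a ∧ b ≡ true → b ≡ true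
∧-elimʳ {true} p = p

∧-intro : ∀ {a b} → a ≡ true → b ≡ true → a ∧ b ≡ true
∧-intro refl refl = refl

∨-elim : ∀ {a b} → a ∨ b ≡ true → a ≡ true ⊎ b ≡ true
∨-elim {true} _ = inj₁ refl
∨-elim {false} p = inj₂ p

∨-introˡ : ∀ {a b} → a ≡ true → a ∨ b ≡ true
∨-introˡ refl = refl

∨-introʳ : ∀ {a b} → b ≡ true → a ∨ b ≡ true
∨-introʳ {true} _ = refl
∨-introʳ {false} p = p

not-true⇒false : ∀ {a} → not a ≡ true → a ≡ false
not-true⇒false {false} _ = refl

false⇒not-true : ∀ {a} → a ≡ false → not a ≡ true
false⇒not-true refl = refl

true≢false : ∀ {a} → a ≡ true → a ≢ false
true≢false refl ()

¬true⇒false : ∀ a → ¬ a ≡ true → a ≡ false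
¬true⇒false true ¬t = ⊥-elim (¬t refl)
¬true⇒false false _ = refl

true⇔true⇒≡ : ∀ {a b} → (a ≡ true → b ≡ true) → (b ≡ true → a ≡ true) → a ≡ b
true⇔true⇒≡ {true} {true} _ _ = refl
true⇔true⇒≡ {true} {false} f _ = sym (f refl)
true⇔true⇒≡ {false} {true} _ g = g refl
true⇔true⇒≡ {false} {false} _ _ = refl

T⇒≡true : ∀ {a} → T a → a ≡ true
T⇒≡true = Equivalence.to Bool.T-≡

≡true⇒T : ∀ {a} → a ≡ true → T a
≡true⇒T = Equivalence.from Bool.T-≡

filterᵇ-∷ : ∀ (p : A → Bool) x xs →
            filterᵇ p (x ∷ xs) ≡ (if p x then x ∷ filterᵇ p xs else filterᵇ p xs)
filterᵇ-∷ p x xs with p x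
... | true = refl
... | false = refl

module _ {N : ℕ} where

  ==⇒≡ : {i j : Fin N} → i == j ≡ true → i ≡ j
  ==⇒≡ {i} {j} p with i ≟ j
  ... | yes i≡j = i≡j

  ≡⇒== : {i j : Fin N} → i ≡ j → i == j ≡ true
  ≡⇒== {i} {j} i≡j with i ≟ j
  ... | yes _ = refl
  ... | no i≢j = ⊥-elim (i≢j i≡j)

  any-allFin⁻ : (p : Fin N → Bool) → any p (allFin N) ≡ true → ∃ λ i → p i ≡ true
  any-allFin⁻ p h with Any.satisfied (any⁻ p (allFin N) (≡true⇒T h))
  ... | i , pi = i , T⇒≡true pi

  any-allFin⁺ : (p : Fin N → Bool) → ∀ i → p i ≡ true → any p (allFin N) ≡ true
  any-allFin⁺ p i pi = T⇒≡true (any⁺ p (lose (∈-allFin i) (≡true⇒T pi)))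

  all-allFin⁻ : (p : Fin N → Bool) → all p (allFin N) ≡ true → ∀ i → p i ≡ true
  all-allFin⁻ p h i = T⇒≡true (All.lookup (all⁺ p (allFin N) (≡true⇒T h)) (∈-allFin i))

  all-allFin⁺ : (p : Fin N → Bool) → (∀ i → p i ≡ true) → all p (allFin N) ≡ true
  all-allFin⁺ p h = T⇒≡true (all⁻ p {allFin N} (All.tabulate λ {i} _ → ≡true⇒T (h i)))

  all-allFin-false⁻ : (p : Fin N → Bool) → all p (allFin N) ≡ false → ∃ λ i → p i ≡ false
  all-allFin-false⁻ p h with any (not ∘ p) (allFin N) in found
  ... | true = let i , ¬pi = any-allFin⁻ (not ∘ p) found in i , not-true⇒false ¬pi
  ... | false = ⊥-elim (true≢false (all-allFin⁺ p holds) h)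
    where
    holds : ∀ i → p i ≡ true
    holds i with p i in pi
    ... | true = refl
    ... | false = ⊥-elim (true≢false (any-allFin⁺ (not ∘ p) i (cong not pi)) found)

  SameEdge : Fin N → Fin N → Fin N → Fin N → Set
  SameEdge a b u v = (a ≡ u × b ≡ v) ⊎ (a ≡ v × b ≡ u)

  sameEdge⇒SameEdge : ∀ {a b u v} → sameEdge (a , b) u v ≡ true → SameEdge a b u v
  sameEdge⇒SameEdge p with ∨-elim p
  ... | inj₁ q = inj₁ (==⇒≡ (∧-elimˡ q) , ==⇒≡ (∧-elimʳ q))
  ... | inj₂ q = inj₂ (==⇒≡ (∧-elimˡ q) , ==⇒≡ (∧-elimʳ q))

  SameEdge⇒sameEdge : ∀ {a b u v} → SameEdge a b u v → sameEdge (a , b) u v ≡ true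
  SameEdge⇒sameEdge (inj₁ (p , q)) = ∨-introˡ (∧-intro (≡⇒== p) (≡⇒== q))
  SameEdge⇒sameEdge {a} {b} {u} {v} (inj₂ (p , q)) =
    ∨-introʳ {(a == u) ∧ (b == v)} (∧-intro (≡⇒== p) (≡⇒== q))

  ¬SameEdge⇒sameEdge-false : ∀ {a b u v} → ¬ SameEdge a b u v → sameEdge (a , b) u v ≡ false
  ¬SameEdge⇒sameEdge-false {a} {b} {u} {v} ¬s =
    ¬true⇒false (sameEdge (a , b) u v) (¬s ∘ sameEdge⇒SameEdge)

  sameEdge-flip : ∀ (a b u v : Fin N) → sameEdge (a , b) u v ≡ sameEdge (b , a) u v
  sameEdge-flip a b u v =
    true⇔true⇒≡ (λ h → SameEdge⇒sameEdge (flip (sameEdge⇒SameEdge {a} {b} h)))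
                (λ h → SameEdge⇒sameEdge (flip (sameEdge⇒SameEdge {b} {a} h)))
    where
    flip : ∀ {a b} → SameEdge a b u v → SameEdge b a u v
    flip (inj₁ (p , q)) = inj₂ (q , p)
    flip (inj₂ (p , q)) = inj₁ (q , p)

  sameEdge-sym : ∀ (e : Edge N) u v → sameEdge e u v ≡ sameEdge e v u
  sameEdge-sym (a , b) u v = Bool.∨-comm ((a == u) ∧ (b == v)) ((a == v) ∧ (b == u))

  sameEdge-resp : ∀ (e : Edge N) a b u v → sameEdge e a b ≡ true → sameEdge e u v ≡ sameEdge (a , b) u v
  sameEdge-resp (c , d) a b u v p with sameEdge⇒SameEdge {c} {d} p
  ... | inj₁ (refl , refl) = refl
  ... | inj₂ (refl , refl) = sameEdge-flip c d u v

  sameEdge-false-fst : ∀ (a b c d : Fin N) → a ≢ c → a ≢ d → sameEdge (a , b) c d ≡ false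
  sameEdge-false-fst a b c d a≢c a≢d =
    ¬SameEdge⇒sameEdge-false {a} {b} λ { (inj₁ (a≡c , _)) → a≢c a≡c ; (inj₂ (a≡d , _)) → a≢d a≡d }

  sameEdge-false-snd : ∀ (a b c d : Fin N) → b ≢ c → b ≢ d → sameEdge (a , b) c d ≡ false
  sameEdge-false-snd a b c d b≢c b≢d =
    ¬SameEdge⇒sameEdge-false {a} {b} λ { (inj₁ (_ , b≡d)) → b≢d b≡d ; (inj₂ (_ , b≡c)) → b≢c b≡c }

  sameEdge-swap : ∀ (a b u v : Fin N) → sameEdge (a , b) u v ≡ sameEdge (u , v) a b
  sameEdge-swap a b u v =
    true⇔true⇒≡ (λ h → SameEdge⇒sameEdge (swap (sameEdge⇒SameEdge {a} {b} h)))
                (λ h → SameEdge⇒sameEdge (swap (sameEdge⇒SameEdge {u} {v} h)))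
    where
    swap : ∀ {a b u v} → SameEdge a b u v → SameEdge u v a b
    swap (inj₁ (a≡u , b≡v)) = inj₁ (sym a≡u , sym b≡v)
    swap (inj₂ (a≡v , b≡u)) = inj₂ (sym b≡u , sym a≡v)

  adj-sym : ∀ (E : Graph N) u v → adj E u v ≡ adj E v u
  adj-sym [] u v = refl
  adj-sym (e ∷ E) u v = cong₂ _∨_ (sameEdge-sym e u v) (adj-sym E u v)

  adj-removeEdge : ∀ (E : Graph N) u v a b →
                   adj (removeEdge u v E) a b ≡ adj E a b ∧ not (sameEdge (a , b) u v)
  adj-removeEdge [] u v a b = refl
  adj-removeEdge ((c , d) ∷ E) u v a b rewrite filterᵇ-∷ (λ e → not (sameEdge e u v)) (c , d) E =
    cons-case (sameEdge (c , d) u v) refl (sameEdge (c , d) a b) refl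
    where
    open ≡-Reasoning
    rest : adj (removeEdge u v E) a b ≡ adj E a b ∧ not (sameEdge (a , b) u v)
    rest = adj-removeEdge E u v a b
    cons-case : ∀ s → sameEdge (c , d) u v ≡ s → ∀ t → sameEdge (c , d) a b ≡ t →
                adj (if not s then (c , d) ∷ removeEdge u v E else removeEdge u v E) a b
                ≡ (t ∨ adj E a b) ∧ not (sameEdge (a , b) u v)
    cons-case false _ false ab rewrite ab = rest
    cons-case true _ false _ = rest
    cons-case false uv true ab rewrite ab = cong not (sym (trans (sym (sameEdge-resp (c , d) a b u v ab)) uv))
    cons-case true uv true ab = begin
      adj (removeEdge u v E) a b                ≡⟨ rest ⟩
      adj E a b ∧ not (sameEdge (a , b) u v)    ≡⟨ cong (λ s → adj E a b ∧ not s) uv′ ⟩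
      adj E a b ∧ false                         ≡⟨ Bool.∧-zeroʳ (adj E a b) ⟩
      false                                     ≡⟨ cong not (sym uv′) ⟩
      not (sameEdge (a , b) u v)                ∎
      where
      uv′ : sameEdge (a , b) u v ≡ true
      uv′ = trans (sym (sameEdge-resp (c , d) a b u v ab)) uv

  adj-removeEdge⁺ : ∀ (E : Graph N) u v x y → adj E x y ≡ true → sameEdge (x , y) u v ≡ false →
                    adj (removeEdge u v E) x y ≡ true
  adj-removeEdge⁺ E u v x y xy other rewrite adj-removeEdge E u v x y | xy | other = refl

  adj-removeEdge⁻ : ∀ (G : Graph N) c d a b → adj (removeEdge c d G) a b ≡ true →
                    adj G a b ≡ true × sameEdge (a , b) c d ≡ false
  adj-removeEdge⁻ G c d a b h with adj G a b | sameEdge (a , b) c d | adj-removeEdge G c d a b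
  ... | true  | false | _ = refl , refl
  ... | true  | true  | eq with () ← trans (sym h) eq
  ... | false | _     | eq with () ← trans (sym h) eq

  removeEdge-sym : ∀ (E : Graph N) u v → removeEdge u v E ≡ removeEdge v u E
  removeEdge-sym E u v = filter-≐ (Bool.T? ∘ λ e → not (sameEdge e u v)) (Bool.T? ∘ λ e → not (sameEdge e v u))
    ((λ {e} → subst T (cong not (sameEdge-sym e u v))) , (λ {e} → subst T (cong not (sameEdge-sym e v u)))) E

  infix 4 _∈_
  _∈_ : Fin N → VSet N → Set
  v ∈ S = lookup S v ≡ true

  ∈-full : ∀ v → v ∈ full {N}
  ∈-full v = lookup∘tabulate (λ _ → true) v

  lookup-extensionality : (A B : VSet N) → (∀ v → lookup A v ≡ lookup B v) → A ≡ B
  lookup-extensionality A B h = trans (sym (tabulate∘lookup A)) (trans (tabulate-cong h) (tabulate∘lookup B))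

  ⊆ᵇ⇒⊆ : ∀ {S X : VSet N} → (S ⊆ᵇ X) ≡ true → ∀ v → v ∈ S → v ∈ X
  ⊆ᵇ⇒⊆ h v v∈A with all-allFin⁻ _ h v
  ... | holds rewrite v∈A = holds

  ⊆⇒⊆ᵇ : ∀ {S X : VSet N} → (∀ v → v ∈ S → v ∈ X) → (S ⊆ᵇ X) ≡ true
  ⊆⇒⊆ᵇ {S} {X} h = all-allFin⁺ _ pointwise
    where
    pointwise : ∀ v → not (lookup S v) ∨ lookup X v ≡ true
    pointwise v with lookup S v in v∈S
    ... | true = h v v∈S
    ... | false = refl

  ⊈ᵇ⇒∃ : ∀ {S X : VSet N} → (S ⊆ᵇ X) ≡ false → ∃ λ v → v ∈ S × lookup X v ≡ false
  ⊈ᵇ⇒∃ {S} h with all-allFin-false⁻ _ h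
  ... | v , v∉X with lookup S v in v∈S
  ...   | true = v , v∈S , v∉X

  data WalkIn (A : Fin N → Fin N → Bool) (S : VSet N) : Fin N → Fin N → Set where
    stop : ∀ {u} → u ∈ S → WalkIn A S u u
    hop  : ∀ {u w v} → u ∈ S → A u w ≡ true → WalkIn A S w v → WalkIn A S u v

  module _ {A : Fin N → Fin N → Bool} {S : VSet N} where

    walk-first∈ : ∀ {u v} → WalkIn A S u v → u ∈ S
    walk-first∈ (stop u∈S) = u∈S
    walk-first∈ (hop u∈S _ _) = u∈S

    walk-last∈ : ∀ {u v} → WalkIn A S u v → v ∈ S
    walk-last∈ (stop v∈S) = v∈S
    walk-last∈ (hop _ _ p) = walk-last∈ p

    walk-++ : ∀ {u w v} → WalkIn A S u w → WalkIn A S w v → WalkIn A S u v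
    walk-++ (stop _) q = q
    walk-++ (hop u∈S a p) q = hop u∈S a (walk-++ p q)

    walk-snoc : ∀ {u w v} → WalkIn A S u w → A w v ≡ true → v ∈ S → WalkIn A S u v
    walk-snoc p a v∈S = walk-++ p (hop (walk-last∈ p) a (stop v∈S))

    walk-reverse : (∀ a b → A a b ≡ A b a) → ∀ {u v} → WalkIn A S u v → WalkIn A S v u
    walk-reverse A-sym (stop u∈S) = stop u∈S
    walk-reverse A-sym (hop u∈S a p) = walk-snoc (walk-reverse A-sym p) (trans (A-sym _ _) a) u∈S

  walk-map : ∀ {A A′ S S′} →
             (∀ a b → a ∈ S → b ∈ S → A a b ≡ true → A′ a b ≡ true) → (∀ a → a ∈ S → a ∈ S′) →
             ∀ {u v} → WalkIn A S u v → WalkIn A′ S′ u v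
  walk-map f g (stop u∈S) = stop (g _ u∈S)
  walk-map f g (hop u∈S a p) = hop (g _ u∈S) (f _ _ u∈S (walk-first∈ p) a) (walk-map f g p)

  Reach⇒WalkIn : ∀ {E : Graph N} {u v} → Reach E u v → WalkIn (adj E) full u v
  Reach⇒WalkIn {u = u} here = stop (∈-full u)
  Reach⇒WalkIn {u = u} (step a p) = hop (∈-full u) a (Reach⇒WalkIn p)

  WalkIn⇒Reach : ∀ {E : Graph N} {S u v} → WalkIn (adj E) S u v → Reach E u v
  WalkIn⇒Reach (stop _) = here
  WalkIn⇒Reach (hop _ a p) = step a (WalkIn⇒Reach p)

  module BreadthFirstSearch (E : Graph N) (S : VSet N) (u : Fin N) where

    seed : VSet N
    seed = tabulate (λ v → (v == u) ∧ lookup S u)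

    stage : ℕ → VSet N
    stage i = iter i (grow E S) seed

    lookup-grow : ∀ R v → lookup (grow E S R) v
                          ≡ lookup R v ∨ (lookup S v ∧ any (λ w → lookup R w ∧ adj E w v) (allFin N))
    lookup-grow R v = lookup∘tabulate _ v

    grow-⊇ : ∀ R v → v ∈ R → v ∈ grow E S R
    grow-⊇ R v v∈R = trans (lookup-grow R v) (∨-introˡ v∈R)

    stage-sound : ∀ i v → v ∈ stage i → WalkIn (adj E) S u v
    stage-sound zero v v∈seed = subst (WalkIn (adj E) S u) (sym (==⇒≡ (∧-elimˡ h))) (stop (∧-elimʳ {v == u} h))
      where
      h : (v == u) ∧ lookup S u ≡ true
      h = trans (sym (lookup∘tabulate (λ v → (v == u) ∧ lookup S u) v)) v∈seed
    stage-sound (suc i) v v∈next with ∨-elim (trans (sym (lookup-grow (stage i) v)) v∈next)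
    ... | inj₁ v∈prev = stage-sound i v v∈prev
    ... | inj₂ v∈S∧new with any-allFin⁻ _ (∧-elimʳ {lookup S v} v∈S∧new)
    ...   | w , w∈prev∧wv = walk-snoc (stage-sound i w (∧-elimˡ w∈prev∧wv))
                                      (∧-elimʳ {lookup (stage i) w} w∈prev∧wv) (∧-elimˡ v∈S∧new)

    Closed : VSet N → Set
    Closed R = grow E S R ≡ R

    ∈⇒∈ₛ : ∀ {R : VSet N} {v} → v ∈ R → v Subset.∈ R
    ∈⇒∈ₛ {R} {v} = lookup⇒[]= v R

    closed-or-grows : ∀ R → Closed R ⊎ Subset.∣ R ∣ < Subset.∣ grow E S R ∣
    closed-or-grows R with any (λ v → lookup (grow E S R) v ∧ not (lookup R v)) (allFin N) in new
    ... | true with any-allFin⁻ _ new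
    ...   | v , v-new = inj₂ (p⊂q⇒∣p∣<∣q∣ {p = R} {q = grow E S R} ((λ {w} w∈R → ∈⇒∈ₛ (grow-⊇ R w ([]=⇒lookup w∈R))) ,
                                          v , ∈⇒∈ₛ (∧-elimˡ v-new) ,
                                          λ v∈R → true≢false ([]=⇒lookup v∈R) (not-true⇒false (∧-elimʳ {lookup (grow E S R) v} v-new))))
    closed-or-grows R | false = inj₁ (lookup-extensionality _ _ unchanged)
      where
      unchanged : ∀ v → lookup (grow E S R) v ≡ lookup R v
      unchanged v with lookup R v in v∈R
      ... | true = grow-⊇ R v v∈R
      ... | false with lookup (grow E S R) v in v∈grow
      ...   | false = refl
      ...   | true = ⊥-elim (true≢false (any-allFin⁺ _ v (∧-intro v∈grow (false⇒not-true v∈R))) new)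

    u∈seed : u ∈ S → u ∈ seed
    u∈seed u∈S = trans (lookup∘tabulate (λ v → (v == u) ∧ lookup S u) u) (∧-intro (≡⇒== refl) u∈S)

    closed-or-large : u ∈ S → ∀ i → Closed (stage i) ⊎ i < Subset.∣ stage i ∣
    closed-or-large u∈S zero = inj₂ (≤-trans (s≤s z≤n) (x∈p⇒∣p-x∣<∣p∣ (∈⇒∈ₛ {seed} (u∈seed u∈S))))
    closed-or-large u∈S (suc i) with closed-or-large u∈S i
    ... | inj₁ closed = inj₁ (cong (grow E S) closed)
    ... | inj₂ large with closed-or-grows (stage i)
    ...   | inj₁ closed = inj₁ (cong (grow E S) closed)
    ...   | inj₂ grows = inj₂ (≤-trans (s≤s large) grows)

    stage-N-closed : u ∈ S → Closed (stage N)
    stage-N-closed u∈S with closed-or-large u∈S N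
    ... | inj₁ closed = closed
    ... | inj₂ large = ⊥-elim (<-irrefl refl (≤-trans large (∣p∣≤n (stage N))))

    closed-walk : ∀ R → Closed R → ∀ {w v} → w ∈ R → WalkIn (adj E) S w v → v ∈ R
    closed-walk R closed w∈R (stop _) = w∈R
    closed-walk R closed {w} w∈R (hop {w = w′} _ ww′ p) = closed-walk R closed w′∈R p
      where
      w′∈R : w′ ∈ R
      w′∈R = trans (sym (cong (λ X → lookup X w′) closed))
                   (trans (lookup-grow R w′) (∨-introʳ {lookup R w′} (∧-intro (walk-first∈ p) (any-allFin⁺ _ w (∧-intro w∈R ww′)))))

    stage-⊇-seed : ∀ i v → v ∈ seed → v ∈ stage i
    stage-⊇-seed zero v v∈seed = v∈seed
    stage-⊇-seed (suc i) v v∈seed = grow-⊇ (stage i) v (stage-⊇-seed i v v∈seed)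

    stage-N-complete : ∀ v → WalkIn (adj E) S u v → v ∈ stage N
    stage-N-complete v p = closed-walk (stage N) (stage-N-closed (walk-first∈ p)) (stage-⊇-seed N u (u∈seed (walk-first∈ p))) p

  reachIn⇒WalkIn : ∀ (E : Graph N) S u v → v ∈ reachIn E S u → WalkIn (adj E) S u v
  reachIn⇒WalkIn E S u = BreadthFirstSearch.stage-sound E S u N

  WalkIn⇒reachIn : ∀ (E : Graph N) S u v → WalkIn (adj E) S u v → v ∈ reachIn E S u
  WalkIn⇒reachIn E S u = BreadthFirstSearch.stage-N-complete E S u

  connectedAtᵇ⇒ : ∀ (E : Graph N) S u → connectedAtᵇ E S u ≡ true → u ∈ S × (∀ v → v ∈ S → WalkIn (adj E) S u v)
  connectedAtᵇ⇒ E S u h =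
    ∧-elimˡ h , λ v v∈S → reachIn⇒WalkIn E S u v (⊆ᵇ⇒⊆ {S} {reachIn E S u} (∧-elimʳ {lookup S u} h) v v∈S)

  connectedAtᵇ⇐ : ∀ (E : Graph N) S u → u ∈ S → (∀ v → v ∈ S → WalkIn (adj E) S u v) → connectedAtᵇ E S u ≡ true
  connectedAtᵇ⇐ E S u u∈S h = ∧-intro u∈S (⊆⇒⊆ᵇ {S} {reachIn E S u} λ v v∈S → WalkIn⇒reachIn E S u v (h v v∈S))

  component⇒Reach : ∀ (E : Graph N) u v → v ∈ component E u → Reach E u v
  component⇒Reach E u v h = WalkIn⇒Reach (reachIn⇒WalkIn E full u v h)

  Reach⇒component : ∀ (E : Graph N) u v → Reach E u v → v ∈ component E u
  Reach⇒component E u v h = WalkIn⇒reachIn E full u v (Reach⇒WalkIn h)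

count-∷ : ∀ (p : A → Bool) x xs → count p (x ∷ xs) ≡ (if p x then 1 else 0) + count p xs
count-∷ p x xs with p x
... | true = refl
... | false = refl

count-++ : ∀ (p : A → Bool) xs ys → count p (xs ++ ys) ≡ count p xs + count p ys
count-++ p xs ys = trans (cong length (filter-++ _ xs ys)) (length-++ (filterᵇ p xs))

count-map : ∀ (p : B → Bool) (f : A → B) xs → count p (map f xs) ≡ count (λ x → p (f x)) xs
count-map p f [] = refl
count-map p f (x ∷ xs) rewrite count-∷ p (f x) (map f xs) | count-∷ (λ x → p (f x)) x xs | count-map p f xs = refl

count-cong : ∀ (p q : A → Bool) xs → (∀ x → p x ≡ q x) → count p xs ≡ count q xs
count-cong p q [] h = refl
count-cong p q (x ∷ xs) h rewrite count-∷ p x xs | count-∷ q x xs | h x | count-cong p q xs h = refl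

count-const-false : ∀ (xs : List A) → count (λ _ → false) xs ≡ 0
count-const-false [] = refl
count-const-false (x ∷ xs) = count-const-false xs

count-≤-count+count-∧-not : ∀ (p q : A → Bool) xs → count p xs ≤ count q xs + count (λ x → p x ∧ not (q x)) xs
count-≤-count+count-∧-not p q [] = z≤n
count-≤-count+count-∧-not p q (x ∷ xs)
  rewrite count-∷ p x xs | count-∷ q x xs | count-∷ (λ x → p x ∧ not (q x)) x xs with p x | q x
... | true  | true  = s≤s (count-≤-count+count-∧-not p q xs)
... | true  | false = subst (suc (count p xs) ≤_) (sym (+-suc (count q xs) _)) (s≤s (count-≤-count+count-∧-not p q xs))
... | false | true  = ≤-trans (count-≤-count+count-∧-not p q xs) (n≤1+n _)
... | false | false = count-≤-count+count-∧-not p q xs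

count-∨-disjoint : ∀ (p q r : A → Bool) xs → (∀ x → p x ≡ q x ∨ r x) → (∀ x → q x ∧ r x ≡ false) →
                   count p xs ≡ count q xs + count r xs
count-∨-disjoint p q r [] split disjoint = refl
count-∨-disjoint p q r (x ∷ xs) split disjoint
  rewrite count-∷ p x xs | count-∷ q x xs | count-∷ r x xs | split x | count-∨-disjoint p q r xs split disjoint
  with q x in qx | r x in rx
... | true  | true  = ⊥-elim (true≢false (∧-intro qx rx) (disjoint x))
... | true  | false = refl
... | false | true  = sym (+-suc _ _)
... | false | false = refl

count-tabulate-all : ∀ {n} (g : Fin n → A) (p : A → Bool) → (∀ i → p (g i) ≡ true) → count p (List.tabulate g) ≡ n
count-tabulate-all {n = zero} g p h = refl
count-tabulate-all {n = suc n} g p h rewrite count-∷ p (g fzero) (List.tabulate (g ∘′ fsuc)) | h fzero =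
  cong suc (count-tabulate-all (g ∘′ fsuc) p (λ i → h (fsuc i)))

count-tabulate-none : ∀ {n} (g : Fin n → A) (p : A → Bool) → (∀ i → p (g i) ≡ false) → count p (List.tabulate g) ≡ 0
count-tabulate-none {n = zero} g p h = refl
count-tabulate-none {n = suc n} g p h rewrite count-∷ p (g fzero) (List.tabulate (g ∘′ fsuc)) | h fzero =
  count-tabulate-none (g ∘′ fsuc) p (λ i → h (fsuc i))

count-tabulate≤1 : ∀ {n} (g : Fin n → A) (p : A → Bool) →
                   (∀ i j → p (g i) ≡ true → p (g j) ≡ true → i ≡ j) → count p (List.tabulate g) ≤ 1
count-tabulate≤1 {n = zero} g p h = z≤n
count-tabulate≤1 {n = suc n} g p h rewrite count-∷ p (g fzero) (List.tabulate (g ∘′ fsuc)) with p (g fzero) in p0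
... | true = ≤-reflexive (cong suc (count-tabulate-none (g ∘′ fsuc) p others))
  where
  others : ∀ i → p (g (fsuc i)) ≡ false
  others i with p (g (fsuc i)) in pi
  ... | false = refl
  ... | true with h fzero (fsuc i) p0 pi
  ...   | ()
... | false = count-tabulate≤1 (g ∘′ fsuc) p (λ i j pi pj → suc-injective (h (fsuc i) (fsuc j) pi pj))

-- Components of trees

module _ {N : ℕ} where

  Reach-trans : ∀ {E : Graph N} {x y z} → Reach E x y → Reach E y z → Reach E x z
  Reach-trans here q = q
  Reach-trans (step a p) q = step a (Reach-trans p q)

  Reach-sym : ∀ {E : Graph N} {x y} → Reach E x y → Reach E y x
  Reach-sym {E} p = WalkIn⇒Reach (walk-reverse (adj-sym E) (Reach⇒WalkIn p))

  edge⇒Reach : ∀ {E : Graph N} {x y} → adj E x y ≡ true → Reach E x y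
  edge⇒Reach a = step a here

  Reach-mono : ∀ {G G′ : Graph N} → (∀ a b → adj G a b ≡ true → adj G′ a b ≡ true) →
               ∀ {y v} → Reach G y v → Reach G′ y v
  Reach-mono f here = here
  Reach-mono f (step e h) = step (f _ _ e) (Reach-mono f h)

  Reach-[] : ∀ {x y} → Reach ([] {A = Edge N}) x y → x ≡ y
  Reach-[] here = refl

  Reach-∷⁻ : ∀ (L : Graph N) a b {x y} → Reach ((a , b) ∷ L) x y →
             Reach L x y ⊎ ((Reach L x a × Reach L b y) ⊎ (Reach L x b × Reach L a y))
  Reach-∷⁻ L a b here = inj₁ here
  Reach-∷⁻ L a b {x} (step {w = x′} h p) with Reach-∷⁻ L a b p | ∨-elim {sameEdge (a , b) x x′} h
  ... | inj₁ q                 | inj₂ e = inj₁ (step e q)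
  ... | inj₂ (inj₁ (q₁ , q₂)) | inj₂ e = inj₂ (inj₁ (step e q₁ , q₂))
  ... | inj₂ (inj₂ (q₁ , q₂)) | inj₂ e = inj₂ (inj₂ (step e q₁ , q₂))
  ... | rest | inj₁ e with sameEdge⇒SameEdge {a = a} {b = b} {u = x} {v = x′} e | rest
  ...   | inj₁ (refl , refl) | inj₁ q                 = inj₂ (inj₁ (here , q))
  ...   | inj₁ (refl , refl) | inj₂ (inj₁ (q₁ , q₂)) = inj₁ (Reach-trans (Reach-sym q₁) q₂)
  ...   | inj₁ (refl , refl) | inj₂ (inj₂ (q₁ , q₂)) = inj₁ q₂
  ...   | inj₂ (refl , refl) | inj₁ q                 = inj₂ (inj₂ (here , q))
  ...   | inj₂ (refl , refl) | inj₂ (inj₁ (q₁ , q₂)) = inj₁ q₂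
  ...   | inj₂ (refl , refl) | inj₂ (inj₂ (q₁ , q₂)) = inj₁ (Reach-trans (Reach-sym q₁) q₂)

  leastInComponent : Graph N → Fin N → Bool
  leastInComponent L v = all (λ w → not ((toℕ w <ᵇ toℕ v) ∧ lookup (component L w) v)) (allFin N)

  leastInComponent⇒ : ∀ L v → leastInComponent L v ≡ true → ∀ w → toℕ w < toℕ v → ¬ Reach L w v
  leastInComponent⇒ L v least w w<v w⇝v
    with all-allFin⁻ _ least w
  ... | never rewrite T⇒≡true (<⇒<ᵇ w<v) | Reach⇒component L w v w⇝v = true≢false never refl

  leastInComponent⇐ : ∀ L v → (∀ w → toℕ w < toℕ v → ¬ Reach L w v) → leastInComponent L v ≡ true
  leastInComponent⇐ L v h = all-allFin⁺ _ never
    where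
    never : ∀ w → not ((toℕ w <ᵇ toℕ v) ∧ lookup (component L w) v) ≡ true
    never w with toℕ w <ᵇ toℕ v in w<v | lookup (component L w) v in w⇝v
    ... | true  | true  = ⊥-elim (h w (<ᵇ⇒< _ _ (≡true⇒T w<v)) (component⇒Reach L w v w⇝v))
    ... | true  | false = refl
    ... | false | _     = refl

  ¬leastInComponent⇒ : ∀ L v → leastInComponent L v ≡ false → ∃ λ w → toℕ w < toℕ v × Reach L w v
  ¬leastInComponent⇒ L v h with all-allFin-false⁻ _ h
  ... | w , _ with toℕ w <ᵇ toℕ v in w<v | lookup (component L w) v in w⇝v
  ...   | true | true = w , <ᵇ⇒< _ _ (≡true⇒T w<v) , component⇒Reach L w v w⇝v

  leastInComponent-unique : ∀ L x y → leastInComponent L x ≡ true → leastInComponent L y ≡ true →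
                            Reach L x y → x ≡ y
  leastInComponent-unique L x y x-least y-least x⇝y with <-cmp (toℕ x) (toℕ y)
  ... | tri< x<y _ _ = ⊥-elim (leastInComponent⇒ L y y-least x x<y x⇝y)
  ... | tri≈ _ x≡y _ = toℕ-injective x≡y
  ... | tri> _ _ y<x = ⊥-elim (leastInComponent⇒ L x x-least y y<x (Reach-sym x⇝y))

  componentCount : Graph N → ℕ
  componentCount L = count (leastInComponent L) (allFin N)

  -- A new edge ab merges at most two components, so at most one vertex stops being least:
  -- both candidates would be reached from a smaller vertex through ab, in opposite directions.
  leastInComponent-∷-lost-unique : ∀ L a b v₁ v₂ →
    leastInComponent L v₁ ∧ not (leastInComponent ((a , b) ∷ L) v₁) ≡ true →
    leastInComponent L v₂ ∧ not (leastInComponent ((a , b) ∷ L) v₂) ≡ true → v₁ ≡ v₂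
  leastInComponent-∷-lost-unique L a b v₁ v₂ h₁ h₂ =
    lost (¬leastInComponent⇒ _ v₁ (not-true⇒false (∧-elimʳ {leastInComponent L v₁} h₁)))
         (¬leastInComponent⇒ _ v₂ (not-true⇒false (∧-elimʳ {leastInComponent L v₂} h₂)))
    where
    least₁ : leastInComponent L v₁ ≡ true
    least₁ = ∧-elimˡ h₁
    least₂ : leastInComponent L v₂ ≡ true
    least₂ = ∧-elimˡ h₂
    crossed : ∀ {w₁ w₂ c d} → toℕ w₁ < toℕ v₁ → toℕ w₂ < toℕ v₂ →
              Reach L w₁ c → Reach L d v₁ → Reach L w₂ d → Reach L c v₂ → ⊥
    crossed {w₁} {w₂} w₁<v₁ w₂<v₂ w₁⇝c d⇝v₁ w₂⇝d c⇝v₂ =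
      <-irrefl refl (<-trans (≤-<-trans v₂≤w₁ w₁<v₁) (≤-<-trans v₁≤w₂ w₂<v₂))
      where
      v₂≤w₁ : toℕ v₂ ≤ toℕ w₁
      v₂≤w₁ = ≮⇒≥ (λ w₁<v₂ → leastInComponent⇒ L v₂ least₂ w₁ w₁<v₂ (Reach-trans w₁⇝c c⇝v₂))
      v₁≤w₂ : toℕ v₁ ≤ toℕ w₂
      v₁≤w₂ = ≮⇒≥ (λ w₂<v₁ → leastInComponent⇒ L v₁ least₁ w₂ w₂<v₁ (Reach-trans w₂⇝d d⇝v₁))
    lost : (∃ λ w → toℕ w < toℕ v₁ × Reach ((a , b) ∷ L) w v₁) →
           (∃ λ w → toℕ w < toℕ v₂ × Reach ((a , b) ∷ L) w v₂) → v₁ ≡ v₂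
    lost (w₁ , w₁<v₁ , p₁) (w₂ , w₂<v₂ , p₂) with Reach-∷⁻ L a b p₁ | Reach-∷⁻ L a b p₂
    ... | inj₁ q | _ = ⊥-elim (leastInComponent⇒ L v₁ least₁ w₁ w₁<v₁ q)
    ... | _ | inj₁ q = ⊥-elim (leastInComponent⇒ L v₂ least₂ w₂ w₂<v₂ q)
    ... | inj₂ (inj₁ (_ , b⇝v₁)) | inj₂ (inj₁ (_ , b⇝v₂)) =
      leastInComponent-unique L v₁ v₂ least₁ least₂ (Reach-trans (Reach-sym b⇝v₁) b⇝v₂)
    ... | inj₂ (inj₂ (_ , a⇝v₁)) | inj₂ (inj₂ (_ , a⇝v₂)) =
      leastInComponent-unique L v₁ v₂ least₁ least₂ (Reach-trans (Reach-sym a⇝v₁) a⇝v₂)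
    ... | inj₂ (inj₁ (w₁⇝a , b⇝v₁)) | inj₂ (inj₂ (w₂⇝b , a⇝v₂)) =
      ⊥-elim (crossed w₁<v₁ w₂<v₂ w₁⇝a b⇝v₁ w₂⇝b a⇝v₂)
    ... | inj₂ (inj₂ (w₁⇝b , a⇝v₁)) | inj₂ (inj₁ (w₂⇝a , b⇝v₂)) =
      ⊥-elim (crossed w₁<v₁ w₂<v₂ w₁⇝b a⇝v₁ w₂⇝a b⇝v₂)

  componentCount-∷ : ∀ L a b → componentCount L ≤ componentCount ((a , b) ∷ L) + 1
  componentCount-∷ L a b =
    ≤-trans (count-≤-count+count-∧-not (leastInComponent L) (leastInComponent ((a , b) ∷ L)) (allFin N))
            (+-monoʳ-≤ (componentCount ((a , b) ∷ L)) (count-tabulate≤1 id _ (leastInComponent-∷-lost-unique L a b)))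

  componentCount-[] : componentCount [] ≡ N
  componentCount-[] = count-tabulate-all id (leastInComponent []) λ v →
    leastInComponent⇐ [] v λ w w<v w⇝v → <-irrefl (cong toℕ (Reach-[] w⇝v)) w<v

  vertices≤componentCount+edges : ∀ L → N ≤ componentCount L + length L
  vertices≤componentCount+edges [] = ≤-reflexive (trans (sym componentCount-[]) (sym (+-identityʳ _)))
  vertices≤componentCount+edges ((a , b) ∷ L) = begin
    N                                               ≤⟨ vertices≤componentCount+edges L ⟩
    componentCount L + length L                     ≤⟨ +-monoˡ-≤ (length L) (componentCount-∷ L a b) ⟩
    componentCount ((a , b) ∷ L) + 1 + length L     ≡⟨ +-assoc (componentCount ((a , b) ∷ L)) 1 (length L) ⟩
    componentCount ((a , b) ∷ L) + length ((a , b) ∷ L) ∎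
    where open ≤-Reasoning

  connected⇒vertices≤1+edges : ∀ L → (∀ x y → Reach L x y) → N ≤ suc (length L)
  connected⇒vertices≤1+edges L connected =
    ≤-trans (vertices≤componentCount+edges L)
            (+-monoˡ-≤ (length L) (count-tabulate≤1 id (leastInComponent L) λ x y x-least y-least →
                                     leastInComponent-unique L x y x-least y-least (connected x y)))

  length-removeEdge< : ∀ (E : Graph N) u v → adj E u v ≡ true → length (removeEdge u v E) < length E
  length-removeEdge< E u v uv =
    filter-notAll (Bool.T? ∘ (λ e → not (sameEdge e u v))) E (Any.map T⇒¬T-not (any⁻ (λ e → sameEdge e u v) E (≡true⇒T uv)))
    where
    T⇒¬T-not : ∀ {b} → T b → ¬ T (not b)
    T⇒¬T-not {true} _ ()

  Reach-removeEdge : ∀ (E : Graph N) u v → Reach (removeEdge u v E) u v →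
                     ∀ {x y} → Reach E x y → Reach (removeEdge u v E) x y
  Reach-removeEdge E u v u⇝v here = here
  Reach-removeEdge E u v u⇝v {x} (step {w = x′} xx′ p) with sameEdge (x , x′) u v in removed
  ... | false = step (adj-removeEdge⁺ E u v x x′ xx′ removed) (Reach-removeEdge E u v u⇝v p)
  ... | true with sameEdge⇒SameEdge {a = x} {b = x′} removed
  ...   | inj₁ (refl , refl) = Reach-trans u⇝v (Reach-removeEdge E u v u⇝v p)
  ...   | inj₂ (refl , refl) = Reach-trans (Reach-sym u⇝v) (Reach-removeEdge E u v u⇝v p)

  tree-removeEdge-separates : ∀ (E : Graph N) → IsTree N E → ∀ u v → adj E u v ≡ true →
                              ¬ Reach (removeEdge u v E) u v
  tree-removeEdge-separates E (size , connected) u v uv u⇝v = <-irrefl refl (begin-strict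
    N                                   ≤⟨ connected⇒vertices≤1+edges (removeEdge u v E) still-connected ⟩
    suc (length (removeEdge u v E))     <⟨ s≤s (length-removeEdge< E u v uv) ⟩
    suc (length E)                      ≡⟨ trans (+-comm 1 (length E)) size ⟩
    N                                   ∎)
    where
    open ≤-Reasoning
    still-connected : ∀ x y → Reach (removeEdge u v E) x y
    still-connected x y = Reach-removeEdge E u v u⇝v (connected x y)


-- Counting subtrees across a bridge

count-allSubsets-suc : ∀ {n} (p : Vec Bool (suc n) → Bool) →
  count p (allSubsets (suc n)) ≡ count (λ S → p (true ∷ S)) (allSubsets n) + count (λ S → p (false ∷ S)) (allSubsets n)
count-allSubsets-suc {n} p = trans (count-++ p (map (true ∷_) (allSubsets n)) (map (false ∷_) (allSubsets n)))
                                   (cong₂ _+_ (count-map p (true ∷_) (allSubsets n)) (count-map p (false ∷_) (allSubsets n)))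

-- A structurally recursive copy of _⊆ᵇ_, so that subset counts can be computed coordinate by coordinate.
_⊆ᵇ′_ : ∀ {n} → Vec Bool n → Vec Bool n → Bool
[] ⊆ᵇ′ [] = true
(s ∷ S) ⊆ᵇ′ (x ∷ X) = (not s ∨ x) ∧ (S ⊆ᵇ′ X)

⊆ᵇ′⇒⊆ : ∀ {n} (S X : Vec Bool n) → (S ⊆ᵇ′ X) ≡ true → ∀ v → lookup S v ≡ true → lookup X v ≡ true
⊆ᵇ′⇒⊆ (true ∷ S) (x ∷ X) h fzero _ = ∧-elimˡ h
⊆ᵇ′⇒⊆ (s ∷ S) (x ∷ X) h (fsuc v) v∈S = ⊆ᵇ′⇒⊆ S X (∧-elimʳ {not s ∨ x} h) v v∈S

⊆⇒⊆ᵇ′ : ∀ {n} (S X : Vec Bool n) → (∀ v → lookup S v ≡ true → lookup X v ≡ true) → (S ⊆ᵇ′ X) ≡ true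
⊆⇒⊆ᵇ′ [] [] h = refl
⊆⇒⊆ᵇ′ (true ∷ S) (x ∷ X) h = ∧-intro (h fzero refl) (⊆⇒⊆ᵇ′ S X (λ v → h (fsuc v)))
⊆⇒⊆ᵇ′ (false ∷ S) (x ∷ X) h = ⊆⇒⊆ᵇ′ S X (λ v → h (fsuc v))

⊆ᵇ≡⊆ᵇ′ : ∀ {n} (S X : Vec Bool n) → (S ⊆ᵇ X) ≡ (S ⊆ᵇ′ X)
⊆ᵇ≡⊆ᵇ′ S X = true⇔true⇒≡ (λ h → ⊆⇒⊆ᵇ′ S X (⊆ᵇ⇒⊆ {S = S} {X} h))
                          (λ h → ⊆⇒⊆ᵇ {S = S} {X} (⊆ᵇ′⇒⊆ S X h))

countSubsetsOf : ∀ {n} → Vec Bool n → (Vec Bool n → Bool) → ℕ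
countSubsetsOf {n} X φ = count (λ S → (S ⊆ᵇ′ X) ∧ φ S) (allSubsets n)

countSubsetsOf-∷ : ∀ {n} x (X : Vec Bool n) φ →
  countSubsetsOf (x ∷ X) φ ≡
  count (λ S → (x ∧ (S ⊆ᵇ′ X)) ∧ φ (true ∷ S)) (allSubsets n) + countSubsetsOf X (φ ∘ (false ∷_))
countSubsetsOf-∷ x X φ = count-allSubsets-suc (λ S → (S ⊆ᵇ′ (x ∷ X)) ∧ φ S)

-- Subsets S of a disjoint union A ∪ B correspond to pairs (S ∩ A, S ∩ B).
countSubsetsOf-disjoint-∪ : ∀ {n} (A B : Vec Bool n) → (∀ i → lookup A i ∧ lookup B i ≡ false) →
                            (φ ψ : Vec Bool n → Bool) →
  countSubsetsOf (A ∪ B) (λ S → φ (S ∩ A) ∧ ψ (S ∩ B)) ≡ countSubsetsOf A φ * countSubsetsOf B ψ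
countSubsetsOf-disjoint-∪ [] [] disjoint φ ψ with φ [] | ψ []
... | true  | true  = refl
... | true  | false = refl
... | false | _     = refl
countSubsetsOf-disjoint-∪ (true ∷ A) (true ∷ B) disjoint φ ψ with () ← disjoint fzero
countSubsetsOf-disjoint-∪ {suc n} (true ∷ A) (false ∷ B) disjoint φ ψ = begin
  countSubsetsOf (true ∷ (A ∪ B)) χ
    ≡⟨ countSubsetsOf-∷ true (A ∪ B) χ ⟩
  countSubsetsOf (A ∪ B) (χ ∘ (true ∷_)) + countSubsetsOf (A ∪ B) (χ ∘ (false ∷_))
    ≡⟨ cong₂ _+_ (countSubsetsOf-disjoint-∪ A B (disjoint ∘ fsuc) (φ ∘ (true ∷_)) (ψ ∘ (false ∷_)))
                 (countSubsetsOf-disjoint-∪ A B (disjoint ∘ fsuc) (φ ∘ (false ∷_)) (ψ ∘ (false ∷_))) ⟩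
  a₁ * b + a₂ * b
    ≡⟨ *-distribʳ-+ b a₁ a₂ ⟨
  (a₁ + a₂) * b
    ≡⟨ cong₂ _*_ (countSubsetsOf-∷ true A φ)
                 (trans (countSubsetsOf-∷ false B ψ) (cong (_+ b) (count-const-false (allSubsets n)))) ⟨
  countSubsetsOf (true ∷ A) φ * countSubsetsOf (false ∷ B) ψ ∎
  where
  open ≡-Reasoning
  χ : Vec Bool (suc n) → Bool
  χ S = φ (S ∩ (true ∷ A)) ∧ ψ (S ∩ (false ∷ B))
  a₁ a₂ b : ℕ
  a₁ = countSubsetsOf A (φ ∘ (true ∷_))
  a₂ = countSubsetsOf A (φ ∘ (false ∷_))
  b = countSubsetsOf B (ψ ∘ (false ∷_))
countSubsetsOf-disjoint-∪ {suc n} (false ∷ A) (true ∷ B) disjoint φ ψ = begin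
  countSubsetsOf (true ∷ (A ∪ B)) χ
    ≡⟨ countSubsetsOf-∷ true (A ∪ B) χ ⟩
  countSubsetsOf (A ∪ B) (χ ∘ (true ∷_)) + countSubsetsOf (A ∪ B) (χ ∘ (false ∷_))
    ≡⟨ cong₂ _+_ (countSubsetsOf-disjoint-∪ A B (disjoint ∘ fsuc) (φ ∘ (false ∷_)) (ψ ∘ (true ∷_)))
                 (countSubsetsOf-disjoint-∪ A B (disjoint ∘ fsuc) (φ ∘ (false ∷_)) (ψ ∘ (false ∷_))) ⟩
  a * b₁ + a * b₂
    ≡⟨ *-distribˡ-+ a b₁ b₂ ⟨
  a * (b₁ + b₂)
    ≡⟨ cong₂ _*_ (trans (countSubsetsOf-∷ false A φ) (cong (_+ a) (count-const-false (allSubsets n))))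
                 (countSubsetsOf-∷ true B ψ) ⟨
  countSubsetsOf (false ∷ A) φ * countSubsetsOf (true ∷ B) ψ ∎
  where
  open ≡-Reasoning
  χ : Vec Bool (suc n) → Bool
  χ S = φ (S ∩ (false ∷ A)) ∧ ψ (S ∩ (true ∷ B))
  a b₁ b₂ : ℕ
  a = countSubsetsOf A (φ ∘ (false ∷_))
  b₁ = countSubsetsOf B (ψ ∘ (true ∷_))
  b₂ = countSubsetsOf B (ψ ∘ (false ∷_))
countSubsetsOf-disjoint-∪ {suc n} (false ∷ A) (false ∷ B) disjoint φ ψ = begin
  countSubsetsOf (false ∷ (A ∪ B)) χ
    ≡⟨ countSubsetsOf-∷ false (A ∪ B) χ ⟩
  count (λ _ → false) (allSubsets n) + countSubsetsOf (A ∪ B) (χ ∘ (false ∷_))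
    ≡⟨ cong₂ _+_ (count-const-false (allSubsets n))
                 (countSubsetsOf-disjoint-∪ A B (disjoint ∘ fsuc) (φ ∘ (false ∷_)) (ψ ∘ (false ∷_))) ⟩
  a * b
    ≡⟨ cong₂ _*_ (trans (countSubsetsOf-∷ false A φ) (cong (_+ a) (count-const-false (allSubsets n))))
                 (trans (countSubsetsOf-∷ false B ψ) (cong (_+ b) (count-const-false (allSubsets n)))) ⟨
  countSubsetsOf (false ∷ A) φ * countSubsetsOf (false ∷ B) ψ ∎
  where
  open ≡-Reasoning
  χ : Vec Bool (suc n) → Bool
  χ S = φ (S ∩ (false ∷ A)) ∧ ψ (S ∩ (false ∷ B))
  a b : ℕ
  a = countSubsetsOf A (φ ∘ (false ∷_))
  b = countSubsetsOf B (ψ ∘ (false ∷_))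

module _ {N : ℕ} where

  fIn : Graph N → VSet N → ℕ
  fIn H Y = count (λ S → (S ⊆ᵇ Y) ∧ isSubtreeᵇ H S) (allSubsets N)

  ∈-∩⁺ : ∀ {S A : VSet N} {v} → v ∈ S → v ∈ A → v ∈ S ∩ A
  ∈-∩⁺ {S} {A} {v} v∈S v∈A = trans (lookup-zipWith _∧_ v S A) (∧-intro v∈S v∈A)

  ∈-∩⁻ˡ : ∀ {S A : VSet N} {v} → v ∈ S ∩ A → v ∈ S
  ∈-∩⁻ˡ {S} {A} {v} h = ∧-elimˡ (trans (sym (lookup-zipWith _∧_ v S A)) h)

  ∈-∩⁻ʳ : ∀ {S A : VSet N} {v} → v ∈ S ∩ A → v ∈ A
  ∈-∩⁻ʳ {S} {A} {v} h = ∧-elimʳ {lookup S v} (trans (sym (lookup-zipWith _∧_ v S A)) h)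

  ∈-∪⁻ : ∀ {A B : VSet N} {v} → v ∈ A ∪ B → v ∈ A ⊎ v ∈ B
  ∈-∪⁻ {A} {B} {v} h = ∨-elim (trans (sym (lookup-zipWith _∨_ v A B)) h)

  ∈-∪⁺ : ∀ {A B : VSet N} {v} → v ∈ A ⊎ v ∈ B → v ∈ A ∪ B
  ∈-∪⁺ {A} {B} {v} h = trans (lookup-zipWith _∨_ v A B) (Sum.[ ∨-introˡ , ∨-introʳ {lookup A v} ] h)

  IsConnected : Graph N → VSet N → Set
  IsConnected H S = ∃ λ u → u ∈ S × (∀ v → v ∈ S → WalkIn (adj H) S u v)

  isSubtreeᵇ⇒IsConnected : ∀ H S → isSubtreeᵇ H S ≡ true → IsConnected H S
  isSubtreeᵇ⇒IsConnected H S h with any-allFin⁻ _ h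
  ... | u , connected = u , connectedAtᵇ⇒ H S u connected

  IsConnected⇒isSubtreeᵇ : ∀ H S → IsConnected H S → isSubtreeᵇ H S ≡ true
  IsConnected⇒isSubtreeᵇ H S (u , u∈S , walks) = any-allFin⁺ _ u (connectedAtᵇ⇐ H S u u∈S walks)

  IsConnected⇒connectedAtᵇ : ∀ H S → IsConnected H S → ∀ w → w ∈ S → connectedAtᵇ H S w ≡ true
  IsConnected⇒connectedAtᵇ H S (u , _ , walks) w w∈S =
    connectedAtᵇ⇐ H S w w∈S λ v v∈S → walk-++ (walk-reverse (adj-sym H) (walks w w∈S)) (walks v v∈S)

  connectedAtᵇ⇒IsConnected : ∀ H S w → connectedAtᵇ H S w ≡ true → IsConnected H S
  connectedAtᵇ⇒IsConnected H S w h = w , connectedAtᵇ⇒ H S w h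

  module Entrance (H : Graph N) (P Q : VSet N) (p : Fin N)
                  (enters-at : ∀ y x → y ∈ Q → x ∈ P → adj H y x ≡ true → x ≡ p)
                  (disjoint : ∀ v → lookup P v ∧ lookup Q v ≡ false) where

    walk-into : ∀ {S} → (∀ v → v ∈ S → v ∈ P ⊎ v ∈ Q) → ∀ {w v} → WalkIn (adj H) S w v → v ∈ P →
                (w ∈ P × WalkIn (adj H) (S ∩ P) w v) ⊎ WalkIn (adj H) (S ∩ P) p v
    walk-into {S} S⊆P∪Q (stop w∈S) v∈P = inj₁ (v∈P , stop (∈-∩⁺ {S} {P} w∈S v∈P))
    walk-into {S} S⊆P∪Q {w} (hop w∈S ww′ q) v∈P with walk-into S⊆P∪Q q v∈P
    ... | inj₂ from-p = inj₂ from-p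
    ... | inj₁ (w′∈P , within) with S⊆P∪Q w w∈S
    ...   | inj₁ w∈P = inj₁ (w∈P , hop (∈-∩⁺ {S} {P} w∈S w∈P) ww′ within)
    ...   | inj₂ w∈Q with enters-at _ _ w∈Q w′∈P ww′
    ...     | refl = inj₂ within

    ∩-connectedAt-entrance : ∀ {S} → (∀ v → v ∈ S → v ∈ P ⊎ v ∈ Q) → IsConnected H S →
                             ∀ {v′} → v′ ∈ S → v′ ∈ P → ∀ {v} → v ∈ S → v ∈ Q →
                             connectedAtᵇ H (S ∩ P) p ≡ true
    ∩-connectedAt-entrance {S} S⊆P∪Q (u , _ , walks) {v′} v′∈S v′∈P {v} v∈S v∈Q
      with walk-into S⊆P∪Q (walk-++ (walk-reverse (adj-sym H) (walks v v∈S)) (walks v′ v′∈S)) v′∈P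
    ... | inj₁ (v∈P , _) = ⊥-elim (true≢false (∧-intro v∈P v∈Q) (disjoint v))
    ... | inj₂ from-p = connectedAtᵇ⇐ H (S ∩ P) p (walk-first∈ from-p) reach
      where
      p∈S : p ∈ S
      p∈S = ∈-∩⁻ˡ {S} {P} (walk-first∈ from-p)
      reach : ∀ x → x ∈ S ∩ P → WalkIn (adj H) (S ∩ P) p x
      reach x x∈S∩P with walk-into S⊆P∪Q (walk-++ (walk-reverse (adj-sym H) (walks p p∈S)) (walks x (∈-∩⁻ˡ {S} {P} x∈S∩P)))
                                   (∈-∩⁻ʳ {S} {P} x∈S∩P)
      ... | inj₁ (_ , within) = within
      ... | inj₂ within = within

  module Bridge (H : Graph N) (A B : VSet N) (a b : Fin N)
                (disjoint : ∀ v → lookup A v ∧ lookup B v ≡ false)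
                (a∈A : a ∈ A) (b∈B : b ∈ B) (ab : adj H a b ≡ true)
                (only-ab : ∀ x y → x ∈ A → y ∈ B → adj H x y ≡ true → x ≡ a × y ≡ b) where

    X : VSet N
    X = A ∪ B

    module EntranceA = Entrance H A B a (λ y x y∈B x∈A yx → proj₁ (only-ab x y x∈A y∈B (trans (adj-sym H x y) yx))) disjoint
    module EntranceB = Entrance H B A b (λ y x y∈A x∈B yx → proj₂ (only-ab y x y∈A x∈B yx))
                                        (λ v → trans (Bool.∧-comm (lookup B v) (lookup A v)) (disjoint v))

    ⊆X⇒ : ∀ S → (S ⊆ᵇ X) ≡ true → ∀ v → v ∈ S → v ∈ A ⊎ v ∈ B
    ⊆X⇒ S h v v∈S = ∈-∪⁻ {A} {B} (⊆ᵇ⇒⊆ {S = S} {X} h v v∈S)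

    ⊆A⇒⊆X : ∀ S → (S ⊆ᵇ A) ≡ true → (S ⊆ᵇ X) ≡ true
    ⊆A⇒⊆X S h = ⊆⇒⊆ᵇ {S = S} {X} λ v v∈S → ∈-∪⁺ {A} {B} (inj₁ (⊆ᵇ⇒⊆ {S = S} {A} h v v∈S))

    ⊆B⇒⊆X : ∀ S → (S ⊆ᵇ B) ≡ true → (S ⊆ᵇ X) ≡ true
    ⊆B⇒⊆X S h = ⊆⇒⊆ᵇ {S = S} {X} λ v v∈S → ∈-∪⁺ {A} {B} (inj₂ (⊆ᵇ⇒⊆ {S = S} {B} h v v∈S))

    subtreeIn : VSet N → VSet N → Bool
    subtreeIn Y S = (S ⊆ᵇ Y) ∧ isSubtreeᵇ H S

    rootedIn : VSet N → Fin N → VSet N → Bool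
    rootedIn Y w S = (S ⊆ᵇ Y) ∧ connectedAtᵇ H S w

    straddles : VSet N → Bool
    straddles S = (S ⊆ᵇ X) ∧ (connectedAtᵇ H (S ∩ A) a ∧ connectedAtᵇ H (S ∩ B) b)

    straddles⇐ : ∀ S → (S ⊆ᵇ X) ≡ true → IsConnected H S → ∀ {v′} → v′ ∈ S → v′ ∈ A →
                 ∀ {v} → v ∈ S → v ∈ B → straddles S ≡ true
    straddles⇐ S S⊆X connected v′∈S v′∈A v∈S v∈B =
      ∧-intro S⊆X (∧-intro (EntranceA.∩-connectedAt-entrance (⊆X⇒ S S⊆X) connected v′∈S v′∈A v∈S v∈B)
                           (EntranceB.∩-connectedAt-entrance (λ v v∈S → Sum.swap (⊆X⇒ S S⊆X v v∈S)) connected v∈S v∈B v′∈S v′∈A))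

    module _ (S : VSet N) (h : straddles S ≡ true) where
      private
        at-a : connectedAtᵇ H (S ∩ A) a ≡ true
        at-a = ∧-elimˡ (∧-elimʳ {S ⊆ᵇ X} h)
        at-b : connectedAtᵇ H (S ∩ B) b ≡ true
        at-b = ∧-elimʳ {connectedAtᵇ H (S ∩ A) a} (∧-elimʳ {S ⊆ᵇ X} h)

      straddles⇒a∈ : a ∈ S
      straddles⇒a∈ = ∈-∩⁻ˡ {S} {A} (∧-elimˡ {lookup (S ∩ A) a} at-a)

      straddles⇒b∈ : b ∈ S
      straddles⇒b∈ = ∈-∩⁻ˡ {S} {B} (∧-elimˡ {lookup (S ∩ B) b} at-b)

      straddles⇒IsConnected : IsConnected H S
      straddles⇒IsConnected = a , straddles⇒a∈ , reach
        where
        widen : ∀ {C : VSet N} {x y} → WalkIn (adj H) (S ∩ C) x y → WalkIn (adj H) S x y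
        widen {C} = walk-map (λ _ _ _ _ e → e) (λ v → ∈-∩⁻ˡ {S} {C})
        reach : ∀ v → v ∈ S → WalkIn (adj H) S a v
        reach v v∈S with ⊆X⇒ S (∧-elimˡ h) v v∈S
        ... | inj₁ v∈A = widen (proj₂ (connectedAtᵇ⇒ H (S ∩ A) a at-a) v (∈-∩⁺ {S} {A} v∈S v∈A))
        ... | inj₂ v∈B = hop straddles⇒a∈ ab (widen (proj₂ (connectedAtᵇ⇒ H (S ∩ B) b at-b) v (∈-∩⁺ {S} {B} v∈S v∈B)))

    subtreeIn-X : ∀ S → subtreeIn X S ≡ subtreeIn A S ∨ (subtreeIn B S ∨ straddles S)
    subtreeIn-X S = true⇔true⇒≡ forward backward
      where
      forward : subtreeIn X S ≡ true → subtreeIn A S ∨ (subtreeIn B S ∨ straddles S) ≡ true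
      forward h with S ⊆ᵇ A in S⊆A | S ⊆ᵇ B in S⊆B
      ... | true  | _    = ∨-introˡ (∧-elimʳ {S ⊆ᵇ X} h)
      ... | false | true = ∨-introˡ (∧-elimʳ {S ⊆ᵇ X} h)
      ... | false | false with ⊈ᵇ⇒∃ {S = S} {A} S⊆A | ⊈ᵇ⇒∃ {S = S} {B} S⊆B
      ...   | v , v∈S , v∉A | v′ , v′∈S , v′∉B with ⊆X⇒ S (∧-elimˡ h) v v∈S | ⊆X⇒ S (∧-elimˡ h) v′ v′∈S
      ...     | inj₁ v∈A | _ = ⊥-elim (true≢false v∈A v∉A)
      ...     | _ | inj₂ v′∈B = ⊥-elim (true≢false v′∈B v′∉B)
      ...     | inj₂ v∈B | inj₁ v′∈A =
        ∨-introʳ {false} (∨-introʳ {false}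
          (straddles⇐ S (∧-elimˡ h) (isSubtreeᵇ⇒IsConnected H S (∧-elimʳ {S ⊆ᵇ X} h)) v′∈S v′∈A v∈S v∈B))
      backward : subtreeIn A S ∨ (subtreeIn B S ∨ straddles S) ≡ true → subtreeIn X S ≡ true
      backward h with ∨-elim {subtreeIn A S} h
      ... | inj₁ inA = ∧-intro (⊆A⇒⊆X S (∧-elimˡ inA)) (∧-elimʳ {S ⊆ᵇ A} inA)
      ... | inj₂ h′ with ∨-elim {subtreeIn B S} h′
      ...   | inj₁ inB = ∧-intro (⊆B⇒⊆X S (∧-elimˡ inB)) (∧-elimʳ {S ⊆ᵇ B} inB)
      ...   | inj₂ across = ∧-intro (∧-elimˡ across) (IsConnected⇒isSubtreeᵇ H S (straddles⇒IsConnected S across))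

    rootedIn-X-b : ∀ S → rootedIn X b S ≡ rootedIn B b S ∨ straddles S
    rootedIn-X-b S = true⇔true⇒≡ forward backward
      where
      forward : rootedIn X b S ≡ true → rootedIn B b S ∨ straddles S ≡ true
      forward h with S ⊆ᵇ B in S⊆B
      ... | true = ∨-introˡ (∧-elimʳ {S ⊆ᵇ X} h)
      ... | false with ⊈ᵇ⇒∃ {S = S} {B} S⊆B
      ...   | v′ , v′∈S , v′∉B with ⊆X⇒ S (∧-elimˡ h) v′ v′∈S
      ...     | inj₂ v′∈B = ⊥-elim (true≢false v′∈B v′∉B)
      ...     | inj₁ v′∈A = ∨-introʳ {false}
        (straddles⇐ S (∧-elimˡ h) (connectedAtᵇ⇒IsConnected H S b (∧-elimʳ {S ⊆ᵇ X} h)) v′∈S v′∈A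
                    (∧-elimˡ (∧-elimʳ {S ⊆ᵇ X} h)) b∈B)
      backward : rootedIn B b S ∨ straddles S ≡ true → rootedIn X b S ≡ true
      backward h with ∨-elim {rootedIn B b S} h
      ... | inj₁ inB = ∧-intro (⊆B⇒⊆X S (∧-elimˡ inB)) (∧-elimʳ {S ⊆ᵇ B} inB)
      ... | inj₂ across = ∧-intro (∧-elimˡ {S ⊆ᵇ X} across)
                                  (IsConnected⇒connectedAtᵇ H S (straddles⇒IsConnected S across) b (straddles⇒b∈ S across))

    ⊆A-¬straddles : ∀ S → (S ⊆ᵇ A) ≡ true → straddles S ≡ true → ⊥
    ⊆A-¬straddles S S⊆A across = true≢false (∧-intro (⊆ᵇ⇒⊆ {S = S} {A} S⊆A b (straddles⇒b∈ S across)) b∈B) (disjoint b)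

    ⊆B-¬straddles : ∀ S → (S ⊆ᵇ B) ≡ true → straddles S ≡ true → ⊥
    ⊆B-¬straddles S S⊆B across = true≢false (∧-intro a∈A (⊆ᵇ⇒⊆ {S = S} {B} S⊆B a (straddles⇒a∈ S across))) (disjoint a)

    ¬subtreeIn-A-B : ∀ S → subtreeIn A S ≡ true → subtreeIn B S ≡ true → ⊥
    ¬subtreeIn-A-B S inA inB with isSubtreeᵇ⇒IsConnected H S (∧-elimʳ {S ⊆ᵇ A} inA)
    ... | u , u∈S , _ =
      true≢false (∧-intro (⊆ᵇ⇒⊆ {S = S} {A} (∧-elimˡ inA) u u∈S) (⊆ᵇ⇒⊆ {S = S} {B} (∧-elimˡ inB) u u∈S)) (disjoint u)

    count-straddles : count straddles (allSubsets N) ≡ fAt H A a * fAt H B b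
    count-straddles = begin
      count straddles (allSubsets N)
        ≡⟨ count-cong _ _ (allSubsets N)
             (λ S → cong (_∧ (connectedAtᵇ H (S ∩ A) a ∧ connectedAtᵇ H (S ∩ B) b)) (⊆ᵇ≡⊆ᵇ′ S X)) ⟩
      countSubsetsOf X (λ S → connectedAtᵇ H (S ∩ A) a ∧ connectedAtᵇ H (S ∩ B) b)
        ≡⟨ countSubsetsOf-disjoint-∪ A B disjoint (λ S → connectedAtᵇ H S a) (λ S → connectedAtᵇ H S b) ⟩
      countSubsetsOf A (λ S → connectedAtᵇ H S a) * countSubsetsOf B (λ S → connectedAtᵇ H S b)
        ≡⟨ cong₂ _*_ (count-cong _ _ (allSubsets N) (λ S → cong (_∧ connectedAtᵇ H S a) (⊆ᵇ≡⊆ᵇ′ S A)))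
                     (count-cong _ _ (allSubsets N) (λ S → cong (_∧ connectedAtᵇ H S b) (⊆ᵇ≡⊆ᵇ′ S B))) ⟨
      fAt H A a * fAt H B b ∎
      where open ≡-Reasoning

    fIn-bridge : fIn H X ≡ fIn H A + (fIn H B + fAt H A a * fAt H B b)
    fIn-bridge = begin
      fIn H X
        ≡⟨ count-∨-disjoint _ (subtreeIn A) _ (allSubsets N) subtreeIn-X
             (λ S → ¬true⇒false _ λ h → A-excludes S (∧-elimˡ h) (∧-elimʳ {subtreeIn A S} h)) ⟩
      fIn H A + count (λ S → subtreeIn B S ∨ straddles S) (allSubsets N)
        ≡⟨ cong (fIn H A +_) (count-∨-disjoint _ (subtreeIn B) straddles (allSubsets N) (λ S → refl)
             (λ S → ¬true⇒false _ λ h → ⊆B-¬straddles S (∧-elimˡ (∧-elimˡ h)) (∧-elimʳ {subtreeIn B S} h))) ⟩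
      fIn H A + (fIn H B + count straddles (allSubsets N))
        ≡⟨ cong (λ c → fIn H A + (fIn H B + c)) count-straddles ⟩
      fIn H A + (fIn H B + fAt H A a * fAt H B b) ∎
      where
      open ≡-Reasoning
      A-excludes : ∀ S → subtreeIn A S ≡ true → subtreeIn B S ∨ straddles S ≡ true → ⊥
      A-excludes S inA h with ∨-elim {subtreeIn B S} h
      ... | inj₁ inB = ¬subtreeIn-A-B S inA inB
      ... | inj₂ across = ⊆A-¬straddles S (∧-elimˡ inA) across

    fAt-bridge : fAt H X b ≡ fAt H B b + fAt H A a * fAt H B b
    fAt-bridge = trans (count-∨-disjoint _ (rootedIn B b) straddles (allSubsets N) rootedIn-X-b
                          (λ S → ¬true⇒false _ λ h → ⊆B-¬straddles S (∧-elimˡ (∧-elimˡ h)) (∧-elimʳ {rootedIn B b S} h)))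
                       (cong (fAt H B b +_) count-straddles)

  module _ (Y : VSet N) where

    AgreeOn : Graph N → Graph N → Set
    AgreeOn H₁ H₂ = ∀ a b → a ∈ Y → b ∈ Y → adj H₁ a b ≡ adj H₂ a b

    private
      walk-transfer : ∀ H₁ H₂ → AgreeOn H₁ H₂ → ∀ {S} → (S ⊆ᵇ Y) ≡ true →
                      ∀ {w v} → WalkIn (adj H₁) S w v → WalkIn (adj H₂) S w v
      walk-transfer H₁ H₂ agree {S} S⊆Y = walk-map (λ a b a∈S b∈S e → trans (sym (agree a b (∈Y a a∈S) (∈Y b b∈S))) e) (λ _ z → z)
        where
        ∈Y : ∀ v → v ∈ S → v ∈ Y
        ∈Y = ⊆ᵇ⇒⊆ {S = S} {Y} S⊆Y

      connectedAtᵇ-transfer : ∀ H₁ H₂ → AgreeOn H₁ H₂ → ∀ S w → (S ⊆ᵇ Y) ≡ true →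
                              connectedAtᵇ H₁ S w ≡ true → connectedAtᵇ H₂ S w ≡ true
      connectedAtᵇ-transfer H₁ H₂ agree S w S⊆Y h with connectedAtᵇ⇒ H₁ S w h
      ... | w∈S , walks = connectedAtᵇ⇐ H₂ S w w∈S λ v v∈S → walk-transfer H₁ H₂ agree S⊆Y (walks v v∈S)

      isSubtreeᵇ-transfer : ∀ H₁ H₂ → AgreeOn H₁ H₂ → ∀ S → (S ⊆ᵇ Y) ≡ true →
                            isSubtreeᵇ H₁ S ≡ true → isSubtreeᵇ H₂ S ≡ true
      isSubtreeᵇ-transfer H₁ H₂ agree S S⊆Y h with isSubtreeᵇ⇒IsConnected H₁ S h
      ... | u , u∈S , walks =
        IsConnected⇒isSubtreeᵇ H₂ S (u , u∈S , λ v v∈S → walk-transfer H₁ H₂ agree S⊆Y (walks v v∈S))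

      agree-sym : ∀ H₁ H₂ → AgreeOn H₁ H₂ → AgreeOn H₂ H₁
      agree-sym H₁ H₂ agree a b a∈Y b∈Y = sym (agree a b a∈Y b∈Y)

      count-⊆-cong : ∀ (φ ψ : VSet N → Bool) → (∀ S → (S ⊆ᵇ Y) ≡ true → φ S ≡ ψ S) →
                     count (λ S → (S ⊆ᵇ Y) ∧ φ S) (allSubsets N) ≡ count (λ S → (S ⊆ᵇ Y) ∧ ψ S) (allSubsets N)
      count-⊆-cong φ ψ h = count-cong _ _ (allSubsets N) pointwise
        where
        pointwise : ∀ S → (S ⊆ᵇ Y) ∧ φ S ≡ (S ⊆ᵇ Y) ∧ ψ S
        pointwise S with S ⊆ᵇ Y in S⊆Y
        ... | true = h S S⊆Y
        ... | false = refl

    fAt-local : ∀ H₁ H₂ → AgreeOn H₁ H₂ → ∀ w → fAt H₁ Y w ≡ fAt H₂ Y w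
    fAt-local H₁ H₂ agree w = count-⊆-cong _ _ λ S S⊆Y →
      true⇔true⇒≡ (connectedAtᵇ-transfer H₁ H₂ agree S w S⊆Y)
                  (connectedAtᵇ-transfer H₂ H₁ (agree-sym H₁ H₂ agree) S w S⊆Y)

    fIn-local : ∀ H₁ H₂ → AgreeOn H₁ H₂ → fIn H₁ Y ≡ fIn H₂ Y
    fIn-local H₁ H₂ agree = count-⊆-cong _ _ λ S S⊆Y →
      true⇔true⇒≡ (isSubtreeᵇ-transfer H₁ H₂ agree S S⊆Y)
                  (isSubtreeᵇ-transfer H₂ H₁ (agree-sym H₁ H₂ agree) S S⊆Y)

  f≡fIn-full : ∀ (H : Graph N) → f H ≡ fIn H full
  f≡fIn-full H = count-cong _ _ (allSubsets N) λ S → cong (_∧ isSubtreeᵇ H S) (sym (⊆⇒⊆ᵇ {S = S} {full} λ v _ → ∈-full v))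

-- The four branches around x_k x_{k+1}

module AlongPath {N : ℕ} (E : Graph N) (n : ℕ) (x : ℕ → Fin N) (path : IsPath E n x) where

  path-edge : ∀ t → t ≤ n → adj E (x t) (x (suc t)) ≡ true
  path-edge = proj₁ path

  x-distinct : ∀ s t → s ≤ suc n → t ≤ suc n → s ≢ t → x s ≢ x t
  x-distinct s t s≤ t≤ s≢t = s≢t ∘ proj₂ path s t s≤ t≤

  path-edges-differ : ∀ s t → s ≤ n → t ≤ n → s ≢ t → sameEdge (x s , x (suc s)) (x t) (x (suc t)) ≡ false
  path-edges-differ s t s≤n t≤n s≢t = ¬SameEdge⇒sameEdge-false same
    where
    same : ¬ SameEdge (x s) (x (suc s)) (x t) (x (suc t))
    same (inj₁ (xs≡xt , _)) = x-distinct s t (m≤n⇒m≤1+n s≤n) (m≤n⇒m≤1+n t≤n) s≢t xs≡xt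
    same (inj₂ (xs≡xt+1 , xs+1≡xt)) = m≢1+n+m t {1} (trans (sym t≡s+1) (cong suc s≡t+1))
      where
      s≡t+1 : s ≡ suc t
      s≡t+1 = proj₂ path s (suc t) (m≤n⇒m≤1+n s≤n) (s≤s t≤n) xs≡xt+1
      t≡s+1 : suc s ≡ t
      t≡s+1 = proj₂ path (suc s) t (s≤s s≤n) (m≤n⇒m≤1+n t≤n) xs+1≡xt

  path-Reach : ∀ (G : Graph N) i j → i ≤ j → (∀ t → i ≤ t → t < j → adj G (x t) (x (suc t)) ≡ true) →
               Reach G (x i) (x j)
  path-Reach G i j i≤j edges with m≤n⇒m<n∨m≡n i≤j
  ... | inj₂ refl = here
  path-Reach G i (suc j) _ edges | inj₁ (s≤s i≤j) =
    Reach-trans (path-Reach G i j i≤j (λ t i≤t t<j → edges t i≤t (m<n⇒m<1+n t<j))) (edge⇒Reach (edges j i≤j ≤-refl))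

  removeEdgesAt : List ℕ → Graph N
  removeEdgesAt = foldr (λ t G → removeEdge (x t) (x (suc t)) G) E

  adj-removeEdgesAt⁻ : ∀ ts a b → adj (removeEdgesAt ts) a b ≡ true →
                       adj E a b ≡ true × (∀ {t} → t ∈ₗ ts → sameEdge (a , b) (x t) (x (suc t)) ≡ false)
  adj-removeEdgesAt⁻ [] a b ab = ab , λ ()
  adj-removeEdgesAt⁻ (t ∷ ts) a b ab with adj-removeEdge⁻ (removeEdgesAt ts) (x t) (x (suc t)) a b ab
  ... | ab′ , ≢t with adj-removeEdgesAt⁻ ts a b ab′
  ...   | abᴱ , ≢ts = abᴱ , λ { (Any.here refl) → ≢t ; (Any.there t∈ts) → ≢ts t∈ts }

  adj-removeEdgesAt⁺ : ∀ ts a b → adj E a b ≡ true → (∀ {t} → t ∈ₗ ts → sameEdge (a , b) (x t) (x (suc t)) ≡ false) →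
                       adj (removeEdgesAt ts) a b ≡ true
  adj-removeEdgesAt⁺ [] a b ab _ = ab
  adj-removeEdgesAt⁺ (t ∷ ts) a b ab ≢ts =
    adj-removeEdge⁺ (removeEdgesAt ts) (x t) (x (suc t)) a b (adj-removeEdgesAt⁺ ts a b ab (≢ts ∘ Any.there)) (≢ts (Any.here refl))

  adj-removePath⁻ : ∀ a b → adj (removePath E n x) a b ≡ true →
                    adj E a b ≡ true × (∀ t → t ≤ n → sameEdge (a , b) (x t) (x (suc t)) ≡ false)
  adj-removePath⁻ a b ab with adj-removeEdgesAt⁻ (upTo (suc n)) a b ab
  ... | abᴱ , ≢path = abᴱ , λ t t≤n → ≢path (∈-upTo⁺ (s≤s t≤n))

  adj-removePath⁺ : ∀ a b → adj E a b ≡ true → (∀ t → t ≤ n → sameEdge (a , b) (x t) (x (suc t)) ≡ false) →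
                    adj (removePath E n x) a b ≡ true
  adj-removePath⁺ a b ab ≢path = adj-removeEdgesAt⁺ (upTo (suc n)) a b ab λ t∈ → ≢path _ (≤-pred (∈-upTo⁻ t∈))

-- p q r u are x_i … x_{i+3}; with k = i + 1 they are the paper's x_{k-1}, x_k, x_{k+1}, x_{k+2}.
module Swap {N : ℕ} (E : Graph N) (tree : IsTree N E) (n : ℕ) (x : ℕ → Fin N) (path : IsPath E n x)
            (i : ℕ) (i+2≤n : suc (suc i) ≤ n) where

  open AlongPath E n x path

  p q r u : Fin N
  p = x i
  q = x (suc i)
  r = x (suc (suc i))
  u = x (suc (suc (suc i)))

  i+1≤n : suc i ≤ n
  i+1≤n = ≤-trans (n≤1+n _) i+2≤n

  i≤n : i ≤ n
  i≤n = ≤-trans (n≤1+n _) i+1≤n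

  x-ahead-distinct : ∀ d s → s ≤ n → suc (d + s) ≤ suc n → x s ≢ x (suc (d + s))
  x-ahead-distinct d s s≤n ahead≤ = x-distinct s _ (m≤n⇒m≤1+n s≤n) ahead≤ (m≢1+n+m s {d})

  p≢r : p ≢ r
  p≢r = x-ahead-distinct 1 i i≤n (s≤s i+1≤n)
  q≢r : q ≢ r
  q≢r = x-ahead-distinct 0 (suc i) i+1≤n (s≤s i+1≤n)
  q≢u : q ≢ u
  q≢u = x-ahead-distinct 1 (suc i) i+1≤n (s≤s i+2≤n)
  r≢u : r ≢ u
  r≢u = x-ahead-distinct 0 (suc (suc i)) i+2≤n (s≤s i+2≤n)

  pq : adj E p q ≡ true
  pq = path-edge i i≤n
  qr : adj E q r ≡ true
  qr = path-edge (suc i) i+1≤n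
  ru : adj E r u ≡ true
  ru = path-edge (suc (suc i)) i+2≤n

  E-pq E-qr E-ru K : Graph N
  E-pq = removeEdge p q E
  E-qr = removeEdge q r E
  E-ru = removeEdge r u E
  K = removeEdge p q (removeEdge q r E-ru)

  NotRemoved : Fin N → Fin N → Set
  NotRemoved a b = sameEdge (a , b) r u ≡ false × sameEdge (a , b) q r ≡ false × sameEdge (a , b) p q ≡ false

  K⁻ : ∀ a b → adj K a b ≡ true → adj E a b ≡ true × NotRemoved a b
  K⁻ a b ab with adj-removeEdge⁻ (removeEdge q r E-ru) p q a b ab
  ... | ab₁ , ≢pq with adj-removeEdge⁻ E-ru q r a b ab₁
  ...   | ab₂ , ≢qr with adj-removeEdge⁻ E r u a b ab₂
  ...     | ab₃ , ≢ru = ab₃ , ≢ru , ≢qr , ≢pq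

  K⁺ : ∀ a b → adj E a b ≡ true → NotRemoved a b → adj K a b ≡ true
  K⁺ a b ab (≢ru , ≢qr , ≢pq) =
    adj-removeEdge⁺ (removeEdge q r E-ru) p q a b (adj-removeEdge⁺ E-ru q r a b (adj-removeEdge⁺ E r u a b ab ≢ru) ≢qr) ≢pq

  K⊆E-pq : ∀ a b → adj K a b ≡ true → adj E-pq a b ≡ true
  K⊆E-pq a b ab with K⁻ a b ab
  ... | abᴱ , _ , _ , ≢pq = adj-removeEdge⁺ E p q a b abᴱ ≢pq

  K⊆E-qr : ∀ a b → adj K a b ≡ true → adj E-qr a b ≡ true
  K⊆E-qr a b ab with K⁻ a b ab
  ... | abᴱ , _ , ≢qr , _ = adj-removeEdge⁺ E q r a b abᴱ ≢qr

  K⊆E-ru : ∀ a b → adj K a b ≡ true → adj E-ru a b ≡ true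
  K⊆E-ru a b ab with K⁻ a b ab
  ... | abᴱ , ≢ru , _ , _ = adj-removeEdge⁺ E r u a b abᴱ ≢ru

  qr∈E-pq : adj E-pq q r ≡ true
  qr∈E-pq = adj-removeEdge⁺ E p q q r qr (sameEdge-false-snd q r p q (p≢r ∘ sym) (q≢r ∘ sym))

  ru∈E-pq : adj E-pq r u ≡ true
  ru∈E-pq = adj-removeEdge⁺ E p q r u ru (sameEdge-false-fst r u p q (p≢r ∘ sym) (q≢r ∘ sym))

  ru∈E-qr : adj E-qr r u ≡ true
  ru∈E-qr = adj-removeEdge⁺ E q r r u ru (sameEdge-false-snd r u q r (q≢u ∘ sym) (r≢u ∘ sym))

  separated-pq : ¬ Reach K p q
  separated-pq h = tree-removeEdge-separates E tree p q pq (Reach-mono K⊆E-pq h)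

  separated-pr : ¬ Reach K p r
  separated-pr h = tree-removeEdge-separates E tree p q pq
    (Reach-trans (Reach-mono K⊆E-pq h) (Reach-sym (edge⇒Reach qr∈E-pq)))

  separated-pu : ¬ Reach K p u
  separated-pu h = tree-removeEdge-separates E tree p q pq
    (Reach-trans (Reach-mono K⊆E-pq h) (Reach-trans (Reach-sym (edge⇒Reach ru∈E-pq)) (Reach-sym (edge⇒Reach qr∈E-pq))))

  separated-qr : ¬ Reach K q r
  separated-qr h = tree-removeEdge-separates E tree q r qr (Reach-mono K⊆E-qr h)

  separated-qu : ¬ Reach K q u
  separated-qu h = tree-removeEdge-separates E tree q r qr
    (Reach-trans (Reach-mono K⊆E-qr h) (Reach-sym (edge⇒Reach ru∈E-qr)))

  separated-ru : ¬ Reach K r u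
  separated-ru h = tree-removeEdge-separates E tree r u ru (Reach-mono K⊆E-ru h)

  path-edge∈K : ∀ t → t ≤ n → t ≢ i → t ≢ suc i → t ≢ suc (suc i) → adj K (x t) (x (suc t)) ≡ true
  path-edge∈K t t≤n t≢i t≢i+1 t≢i+2 = K⁺ _ _ (path-edge t t≤n)
    (path-edges-differ t _ t≤n i+2≤n t≢i+2 , path-edges-differ t _ t≤n i+1≤n t≢i+1 , path-edges-differ t _ t≤n i≤n t≢i)

  before-reaches-p : ∀ j → j ≤ i → Reach K (x j) p
  before-reaches-p j j≤i = path-Reach K j i j≤i λ t _ t<i →
    path-edge∈K t (≤-trans (<⇒≤ t<i) i≤n) (<⇒≢ t<i) (<⇒≢ (m<n⇒m<1+n t<i)) (<⇒≢ (m<n⇒m<1+n (m<n⇒m<1+n t<i)))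

  u-reaches-after : ∀ j → suc (suc (suc i)) ≤ j → j ≤ suc n → Reach K u (x j)
  u-reaches-after j i+3≤j j≤n+1 = path-Reach K _ j i+3≤j λ t i+3≤t t<j →
    path-edge∈K t (≤-pred (<-≤-trans t<j j≤n+1)) (>⇒≢ (≤-trans (s≤s (n≤1+n _)) (≤-trans (n≤1+n _) i+3≤t)))
                (>⇒≢ (≤-trans (n≤1+n _) i+3≤t)) (>⇒≢ i+3≤t)

  root : Fin 4 → Fin N
  root fzero = p
  root (fsuc fzero) = q
  root (fsuc (fsuc fzero)) = r
  root (fsuc (fsuc (fsuc fzero))) = u

  -- The branch of v in T minus pq, qr, ru: 0 for X_{≤k-1}, 1 for X_k, 2 for X_{k+1}, 3 for X_{≥k+2}.
  branch : Fin N → Fin 4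
  branch v = if lookup (component K p) v then # 0
             else if lookup (component K q) v then # 1
             else if lookup (component K r) v then # 2
             else # 3

  ∉component : ∀ {y y′ v} → ¬ Reach K y y′ → Reach K y′ v → lookup (component K y) v ≡ false
  ∉component {y} {y′} {v} y≁y′ y′⇝v =
    ¬true⇒false _ λ y⇝v → y≁y′ (Reach-trans (component⇒Reach K y v y⇝v) (Reach-sym y′⇝v))

  branch-of-reached : ∀ c v → Reach K (root c) v → branch v ≡ c
  branch-of-reached fzero v h rewrite Reach⇒component K p v h = refl
  branch-of-reached (fsuc fzero) v h
    rewrite ∉component separated-pq h | Reach⇒component K q v h = refl
  branch-of-reached (fsuc (fsuc fzero)) v h
    rewrite ∉component separated-pr h | ∉component separated-qr h | Reach⇒component K r v h = refl
  branch-of-reached (fsuc (fsuc (fsuc fzero))) v h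
    rewrite ∉component separated-pu h | ∉component separated-qu h | ∉component separated-ru h = refl

  Reach-E⇒Reach-K-or-root : ∀ {v w} → Reach E v w → Reach K v w ⊎ ∃ λ c → Reach K v (root c)
  Reach-E⇒Reach-K-or-root here = inj₁ here
  Reach-E⇒Reach-K-or-root {v} (step {w = v′} vv′ rest)
    with sameEdge (v , v′) r u in ≟ru | sameEdge (v , v′) q r in ≟qr | sameEdge (v , v′) p q in ≟pq
  ... | true | _ | _ with sameEdge⇒SameEdge {a = v} {b = v′} ≟ru
  ...   | inj₁ (refl , _) = inj₂ (# 2 , here)
  ...   | inj₂ (refl , _) = inj₂ (# 3 , here)
  Reach-E⇒Reach-K-or-root {v} (step {w = v′} vv′ rest) | false | true | _ with sameEdge⇒SameEdge {a = v} {b = v′} ≟qr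
  ...   | inj₁ (refl , _) = inj₂ (# 1 , here)
  ...   | inj₂ (refl , _) = inj₂ (# 2 , here)
  Reach-E⇒Reach-K-or-root {v} (step {w = v′} vv′ rest) | false | false | true with sameEdge⇒SameEdge {a = v} {b = v′} ≟pq
  ...   | inj₁ (refl , _) = inj₂ (# 0 , here)
  ...   | inj₂ (refl , _) = inj₂ (# 1 , here)
  Reach-E⇒Reach-K-or-root {v} (step {w = v′} vv′ rest) | false | false | false with Reach-E⇒Reach-K-or-root rest
  ...   | inj₁ v′⇝w = inj₁ (step (K⁺ v v′ vv′ (≟ru , ≟qr , ≟pq)) v′⇝w)
  ...   | inj₂ (c , v′⇝root) = inj₂ (c , step (K⁺ v v′ vv′ (≟ru , ≟qr , ≟pq)) v′⇝root)

  root-of-branch-reaches : ∀ c v → Reach K v (root c) → Reach K (root (branch v)) v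
  root-of-branch-reaches c v v⇝root =
    subst (λ c → Reach K (root c) v) (sym (branch-of-reached c v (Reach-sym v⇝root))) (Reach-sym v⇝root)

  root-reaches : ∀ v → Reach K (root (branch v)) v
  root-reaches v with Reach-E⇒Reach-K-or-root (proj₂ tree v p)
  ... | inj₁ v⇝p = root-of-branch-reaches (# 0) v v⇝p
  ... | inj₂ (c , v⇝root) = root-of-branch-reaches c v v⇝root

  branch-root : ∀ c → branch (root c) ≡ c
  branch-root c = branch-of-reached c (root c) here

  K-edge-same-branch : ∀ a b → adj K a b ≡ true → branch a ≡ branch b
  K-edge-same-branch a b ab = sym (branch-of-reached (branch a) b (Reach-trans (root-reaches a) (edge⇒Reach ab)))

  S D : Graph N
  S = swapTree E x (suc i)
  D = removePath E n x

  CrossesVia : (Fin 4 → Fin 4 → Bool) → Fin N → Fin N → Set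
  CrossesVia tab a b = ∃ λ c → ∃ λ d → tab c d ≡ true × a ≡ root c × b ≡ root d

  -- Adjacency of branches: the path 0 – 1 – 2 – 3 in T, the path 0 – 2 – 1 – 3 in S.
  T-branch-edge S-branch-edge : Fin 4 → Fin 4 → Bool
  T-branch-edge fzero (fsuc fzero) = true
  T-branch-edge (fsuc fzero) fzero = true
  T-branch-edge (fsuc fzero) (fsuc (fsuc fzero)) = true
  T-branch-edge (fsuc (fsuc fzero)) (fsuc fzero) = true
  T-branch-edge (fsuc (fsuc fzero)) (fsuc (fsuc (fsuc fzero))) = true
  T-branch-edge (fsuc (fsuc (fsuc fzero))) (fsuc (fsuc fzero)) = true
  T-branch-edge _ _ = false
  S-branch-edge fzero (fsuc (fsuc fzero)) = true
  S-branch-edge (fsuc (fsuc fzero)) fzero = true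
  S-branch-edge (fsuc fzero) (fsuc (fsuc (fsuc fzero))) = true
  S-branch-edge (fsuc (fsuc (fsuc fzero))) (fsuc fzero) = true
  S-branch-edge (fsuc fzero) (fsuc (fsuc fzero)) = true
  S-branch-edge (fsuc (fsuc fzero)) (fsuc fzero) = true
  S-branch-edge _ _ = false

  crosses : ∀ {tab a b} c d → tab c d ≡ true → a ≡ root c → b ≡ root d → branch a ≡ branch b ⊎ CrossesVia tab a b
  crosses c d cd a≡ b≡ = inj₂ (c , d , cd , a≡ , b≡)

  E-edge-kinds : ∀ a b → adj E a b ≡ true → branch a ≡ branch b ⊎ CrossesVia T-branch-edge a b
  E-edge-kinds a b ab with sameEdge (a , b) r u in ≟ru | sameEdge (a , b) q r in ≟qr | sameEdge (a , b) p q in ≟pq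
  ... | true | _ | _ with sameEdge⇒SameEdge {a = a} {b = b} ≟ru
  ...   | inj₁ (a≡ , b≡) = crosses (# 2) (# 3) refl a≡ b≡
  ...   | inj₂ (a≡ , b≡) = crosses (# 3) (# 2) refl a≡ b≡
  E-edge-kinds a b ab | false | true | _ with sameEdge⇒SameEdge {a = a} {b = b} ≟qr
  ...   | inj₁ (a≡ , b≡) = crosses (# 1) (# 2) refl a≡ b≡
  ...   | inj₂ (a≡ , b≡) = crosses (# 2) (# 1) refl a≡ b≡
  E-edge-kinds a b ab | false | false | true with sameEdge⇒SameEdge {a = a} {b = b} ≟pq
  ...   | inj₁ (a≡ , b≡) = crosses (# 0) (# 1) refl a≡ b≡
  ...   | inj₂ (a≡ , b≡) = crosses (# 1) (# 0) refl a≡ b≡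
  E-edge-kinds a b ab | false | false | false = inj₁ (K-edge-same-branch a b (K⁺ a b ab (≟ru , ≟qr , ≟pq)))

  S-edge-kinds : ∀ a b → adj S a b ≡ true → branch a ≡ branch b ⊎ CrossesVia S-branch-edge a b
  S-edge-kinds a b ab with ∨-elim {sameEdge (p , r) a b} ab
  ... | inj₁ ≟pr with sameEdge⇒SameEdge {a = p} {b = r} ≟pr
  ...   | inj₁ (a≡ , b≡) = crosses (# 0) (# 2) refl (sym a≡) (sym b≡)
  ...   | inj₂ (b≡ , a≡) = crosses (# 2) (# 0) refl (sym a≡) (sym b≡)
  S-edge-kinds a b ab | inj₂ ab′ with ∨-elim {sameEdge (q , u) a b} ab′
  ... | inj₁ ≟qu with sameEdge⇒SameEdge {a = q} {b = u} ≟qu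
  ...   | inj₁ (a≡ , b≡) = crosses (# 1) (# 3) refl (sym a≡) (sym b≡)
  ...   | inj₂ (b≡ , a≡) = crosses (# 3) (# 1) refl (sym a≡) (sym b≡)
  S-edge-kinds a b ab | inj₂ ab′ | inj₂ ab″ with adj-removeEdge⁻ E-ru p q a b ab″
  ... | ab‴ , ≟pq with adj-removeEdge⁻ E r u a b ab‴
  ...   | abᴱ , ≟ru with sameEdge (a , b) q r in ≟qr
  ...     | false = inj₁ (K-edge-same-branch a b (K⁺ a b abᴱ (≟ru , ≟qr , ≟pq)))
  ...     | true with sameEdge⇒SameEdge {a = a} {b = b} ≟qr
  ...       | inj₁ (a≡ , b≡) = crosses (# 1) (# 2) refl a≡ b≡
  ...       | inj₂ (a≡ , b≡) = crosses (# 2) (# 1) refl a≡ b≡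

  same-branch⇒¬root-edge : ∀ a b → branch a ≡ branch b → ∀ c d → c ≢ d → sameEdge (a , b) (root c) (root d) ≡ false
  same-branch⇒¬root-edge a b same c d c≢d = ¬SameEdge⇒sameEdge-false {a = a} {b = b} joins
    where
    joins : ¬ SameEdge a b (root c) (root d)
    joins (inj₁ (refl , refl)) = c≢d (trans (sym (branch-root c)) (trans same (branch-root d)))
    joins (inj₂ (refl , refl)) = c≢d (trans (sym (branch-root c)) (trans (sym same) (branch-root d)))

  removeEdge-within-branch : ∀ (G : Graph N) c d → c ≢ d → ∀ a b → branch a ≡ branch b →
                             adj (removeEdge (root c) (root d) G) a b ≡ adj G a b
  removeEdge-within-branch G c d c≢d a b same = begin
    adj (removeEdge (root c) (root d) G) a b             ≡⟨ adj-removeEdge G (root c) (root d) a b ⟩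
    adj G a b ∧ not (sameEdge (a , b) (root c) (root d))  ≡⟨ cong (λ s → adj G a b ∧ not s) (same-branch⇒¬root-edge a b same c d c≢d) ⟩
    adj G a b ∧ true                                      ≡⟨ Bool.∧-identityʳ (adj G a b) ⟩
    adj G a b                                             ∎
    where open ≡-Reasoning

  S-within-branch : ∀ a b → branch a ≡ branch b → adj S a b ≡ adj E a b
  S-within-branch a b same = begin
    adj S a b
      ≡⟨ cong₂ (λ s t → s ∨ (t ∨ adj (removeEdge p q E-ru) a b)) (new-edge (# 0) (# 2) (λ ())) (new-edge (# 1) (# 3) (λ ())) ⟩
    adj (removeEdge p q E-ru) a b  ≡⟨ removeEdge-within-branch E-ru (# 0) (# 1) (λ ()) a b same ⟩
    adj E-ru a b                   ≡⟨ removeEdge-within-branch E (# 2) (# 3) (λ ()) a b same ⟩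
    adj E a b                      ∎
    where
    open ≡-Reasoning
    new-edge : ∀ c d → c ≢ d → sameEdge (root c , root d) a b ≡ false
    new-edge c d c≢d = trans (sym (sameEdge-swap a b (root c) (root d))) (same-branch⇒¬root-edge a b same c d c≢d)

  D⊆K : ∀ a b → adj D a b ≡ true → adj K a b ≡ true
  D⊆K a b ab with adj-removePath⁻ a b ab
  ... | abᴱ , ≢path = K⁺ a b abᴱ (≢path _ i+2≤n , ≢path _ i+1≤n , ≢path _ i≤n)

  middleIndex : Fin 4 → ℕ
  middleIndex (fsuc fzero) = suc i
  middleIndex _ = suc (suc i)

  middle-branch-path-vertex : ∀ c j → j ≤ suc n → branch (x j) ≡ c → c ≢ # 0 → c ≢ # 3 → j ≡ middleIndex c
  middle-branch-path-vertex c j j≤n+1 refl ≢0 ≢3 with <-cmp j (suc i)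
  ... | tri< j<i+1 _ _ = ⊥-elim (≢0 (branch-of-reached (# 0) (x j) (Reach-sym (before-reaches-p j (≤-pred j<i+1)))))
  ... | tri≈ _ refl _ = sym (cong middleIndex (branch-root (# 1)))
  ... | tri> _ _ i+1<j with <-cmp j (suc (suc i))
  ...   | tri< j<i+2 _ _ = ⊥-elim (<-irrefl refl (<-≤-trans i+1<j (≤-pred j<i+2)))
  ...   | tri≈ _ refl _ = sym (cong middleIndex (branch-root (# 2)))
  ...   | tri> _ _ i+2<j = ⊥-elim (≢3 (branch-of-reached (# 3) (x j) (u-reaches-after j i+2<j j≤n+1)))

  D-within-middle-branch : ∀ a b → branch a ≡ branch b → branch a ≢ # 0 → branch a ≢ # 3 → adj D a b ≡ adj E a b
  D-within-middle-branch a b same ≢0 ≢3 =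
    true⇔true⇒≡ (λ ab → proj₁ (adj-removePath⁻ a b ab))
                (λ ab → adj-removePath⁺ a b ab λ t t≤n → ¬SameEdge⇒sameEdge-false {a = a} {b = b} (not-path-edge t t≤n))
    where
    not-path-edge : ∀ t → t ≤ n → ¬ SameEdge a b (x t) (x (suc t))
    not-path-edge t t≤n (inj₁ (refl , refl)) = <⇒≢ (n<1+n t)
      (trans (middle-branch-path-vertex _ t (m≤n⇒m≤1+n t≤n) refl ≢0 ≢3)
             (sym (middle-branch-path-vertex _ (suc t) (s≤s t≤n) (sym same) ≢0 ≢3)))
    not-path-edge t t≤n (inj₂ (refl , refl)) = <⇒≢ (n<1+n t)
      (trans (middle-branch-path-vertex _ t (m≤n⇒m≤1+n t≤n) (sym same) ≢0 ≢3)
             (sym (middle-branch-path-vertex _ (suc t) (s≤s t≤n) refl ≢0 ≢3)))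

  confined-walk : ∀ {G₁ G₂ : Graph N} c →
                  (∀ a b → branch a ≡ c → adj G₁ a b ≡ true → branch b ≡ c × adj G₂ a b ≡ true) →
                  ∀ {y v} → Reach G₁ y v → branch y ≡ c → Reach G₂ y v × branch v ≡ c
  confined-walk c stays here y∈c = here , y∈c
  confined-walk c stays (step ab rest) a∈c with stays _ _ a∈c ab
  ... | b∈c , ab′ with confined-walk c stays rest b∈c
  ...   | rest′ , v∈c = step ab′ rest′ , v∈c

  branches : (Fin 4 → Bool) → VSet N
  branches s = tabulate (λ v → s (branch v))

  lookup-branches : ∀ s v → lookup (branches s) v ≡ s (branch v)
  lookup-branches s v = lookup∘tabulate (λ v → s (branch v)) v

  only : Fin 4 → Fin 4 → Bool
  only c d = d == c

  ∈-branches-only : ∀ c v → v ∈ branches (only c) → branch v ≡ c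
  ∈-branches-only c v h = ==⇒≡ (trans (sym (lookup-branches (only c) v)) h)

  same-branch-of-only : ∀ c a b → a ∈ branches (only c) → b ∈ branches (only c) → branch a ≡ branch b
  same-branch-of-only c a b a∈ b∈ = trans (∈-branches-only c a a∈) (sym (∈-branches-only c b b∈))

  component≡branch : ∀ (G : Graph N) c → (∀ v → Reach G (root c) v → branch v ≡ c) →
                     (∀ v → branch v ≡ c → Reach G (root c) v) → component G (root c) ≡ branches (only c)
  component≡branch G c inside reaches = lookup-extensionality _ _ λ v →
    trans (true⇔true⇒≡ (λ h → ≡⇒== (inside v (component⇒Reach G (root c) v h)))
                       (λ h → Reach⇒component G (root c) v (reaches v (==⇒≡ h))))
          (sym (lookup-branches (only c) v))

  root-reaches-branch : ∀ c v → branch v ≡ c → Reach K (root c) v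
  root-reaches-branch c v refl = root-reaches v

  component-after-cut : ∀ c d → c ≢ d → (∀ d′ → T-branch-edge c d′ ≡ true → d′ ≡ d) →
                        component (removeEdge (root c) (root d) E) (root c) ≡ branches (only c)
  component-after-cut c d c≢d leaves-to-d = component≡branch G c
    (λ v h → proj₂ (confined-walk {G₁ = G} {G₂ = G} c stays h (branch-root c)))
    (λ v v∈c → Reach-mono {G = K} {G′ = G} K⊆G (root-reaches-branch c v v∈c))
    where
    G : Graph N
    G = removeEdge (root c) (root d) E
    K⊆G : ∀ a b → adj K a b ≡ true → adj G a b ≡ true
    K⊆G a b ab = trans (removeEdge-within-branch E c d c≢d a b (K-edge-same-branch a b ab)) (proj₁ (K⁻ a b ab))
    stays : ∀ a b → branch a ≡ c → adj G a b ≡ true → branch b ≡ c × adj G a b ≡ true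
    stays a b a∈c ab with adj-removeEdge⁻ E (root c) (root d) a b ab
    ... | abᴱ , not-cd with E-edge-kinds a b abᴱ
    ...   | inj₁ same = trans (sym same) a∈c , ab
    ...   | inj₂ (c′ , d′ , c′d′ , refl , refl) with trans (sym (branch-root c′)) a∈c
    ...     | refl with leaves-to-d d′ c′d′
    ...       | refl = ⊥-elim (true≢false (SameEdge⇒sameEdge {a = root c} {b = root d} (inj₁ (refl , refl))) not-cd)

  component-removePath : ∀ c → c ≢ # 0 → c ≢ # 3 → component D (root c) ≡ branches (only c)
  component-removePath c ≢0 ≢3 = component≡branch D c
    (λ v h → branch-of-reached c v (Reach-mono {G = D} {G′ = K} D⊆K h))
    (λ v v∈c → proj₁ (confined-walk {G₁ = K} {G₂ = D} c stays (root-reaches-branch c v v∈c) (branch-root c)))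
    where
    stays : ∀ a b → branch a ≡ c → adj K a b ≡ true → branch b ≡ c × adj D a b ≡ true
    stays a b a∈c ab = trans (sym same) a∈c ,
                       trans (D-within-middle-branch a b same (≢0 ∘ trans (sym a∈c)) (≢3 ∘ trans (sym a∈c))) (proj₁ (K⁻ a b ab))
      where
      same : branch a ≡ branch b
      same = K-edge-same-branch a b ab

  disjointᵇ : (Fin 4 → Bool) → (Fin 4 → Bool) → Bool
  disjointᵇ s t = all (λ c → not (s c ∧ t c)) (allFin 4)

  crossingAllowedᵇ : (Fin 4 → Fin 4 → Bool) → (Fin 4 → Bool) → (Fin 4 → Bool) → Fin 4 → Fin 4 → Fin 4 → Fin 4 → Bool
  crossingAllowedᵇ tab s t c₀ d₀ c d = not (tab c d ∧ (s c ∧ t d)) ∨ ((c == c₀) ∧ (d == d₀))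

  onlyCrossingᵇ : (Fin 4 → Fin 4 → Bool) → (Fin 4 → Bool) → (Fin 4 → Bool) → Fin 4 → Fin 4 → Bool
  onlyCrossingᵇ tab s t c₀ d₀ = all (λ c → all (crossingAllowedᵇ tab s t c₀ d₀ c) (allFin 4)) (allFin 4)

  -- The hypotheses on the branch sets are Boolean checks over Fin 4, discharged by evaluation.
  module BranchBridge (H : Graph N) (tab : Fin 4 → Fin 4 → Bool)
                      (H-edge-kinds : ∀ a b → adj H a b ≡ true → branch a ≡ branch b ⊎ CrossesVia tab a b)
                      (s t : Fin 4 → Bool) (c₀ d₀ : Fin 4)
                      (disjoint-check : disjointᵇ s t ≡ true) (crossing-check : onlyCrossingᵇ tab s t c₀ d₀ ≡ true)
                      (c₀∈s : s c₀ ≡ true) (d₀∈t : t d₀ ≡ true) (bridge : adj H (root c₀) (root d₀) ≡ true) where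

    disjoint-branches : ∀ c → s c ∧ t c ≡ false
    disjoint-branches c = not-true⇒false (all-allFin⁻ {4} (λ c → not (s c ∧ t c)) disjoint-check c)

    disjoint : ∀ v → lookup (branches s) v ∧ lookup (branches t) v ≡ false
    disjoint v rewrite lookup-branches s v | lookup-branches t v = disjoint-branches (branch v)

    root∈ : ∀ (s : Fin 4 → Bool) c → s c ≡ true → root c ∈ branches s
    root∈ s c c∈s = trans (lookup-branches s (root c)) (trans (cong s (branch-root c)) c∈s)

    only-bridge : ∀ a b → a ∈ branches s → b ∈ branches t → adj H a b ≡ true → a ≡ root c₀ × b ≡ root d₀
    only-bridge a b a∈ b∈ ab with H-edge-kinds a b ab
    ... | inj₁ same = ⊥-elim (true≢false (∧-intro (trans (sym (lookup-branches s a)) a∈)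
                                                  (trans (cong t same) (trans (sym (lookup-branches t b)) b∈)))
                                         (disjoint-branches (branch a)))
    ... | inj₂ (c , d , cd , refl , refl) =
      cong root (==⇒≡ {i = c} (∧-elimˡ c≡c₀∧d≡d₀)) , cong root (==⇒≡ {i = d} (∧-elimʳ {c == c₀} c≡c₀∧d≡d₀))
      where
      c∈s : s c ≡ true
      c∈s = trans (cong s (sym (branch-root c))) (trans (sym (lookup-branches s (root c))) a∈)
      d∈t : t d ≡ true
      d∈t = trans (cong t (sym (branch-root d))) (trans (sym (lookup-branches t (root d))) b∈)
      check : crossingAllowedᵇ tab s t c₀ d₀ c d ≡ true
      check = all-allFin⁻ {4} (crossingAllowedᵇ tab s t c₀ d₀ c)
                (all-allFin⁻ {4} (λ c → all (crossingAllowedᵇ tab s t c₀ d₀ c) (allFin 4)) crossing-check c) d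
      c≡c₀∧d≡d₀ : (c == c₀) ∧ (d == d₀) ≡ true
      c≡c₀∧d≡d₀ = implication (∧-intro cd (∧-intro c∈s d∈t)) check
        where
        implication : ∀ {a b} → a ≡ true → not a ∨ b ≡ true → b ≡ true
        implication refl b = b

    open Bridge H (branches s) (branches t) (root c₀) (root d₀) disjoint (root∈ s c₀ c₀∈s) (root∈ t d₀ d₀∈t) bridge only-bridge
      public

  sel₀ sel₁ sel₂ sel₃ sel₀₁ sel₃₂ sel₀₂ sel₃₁ : Fin 4 → Bool
  sel₀ = only (# 0)
  sel₁ = only (# 1)
  sel₂ = only (# 2)
  sel₃ = only (# 3)
  sel₀₁ c = sel₀ c ∨ sel₁ c
  sel₃₂ c = sel₃ c ∨ sel₂ c
  sel₀₂ c = sel₀ c ∨ sel₂ c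
  sel₃₁ c = sel₃ c ∨ sel₁ c

  branches-∪ : ∀ s t → branches s ∪ branches t ≡ branches (λ c → s c ∨ t c)
  branches-∪ s t = lookup-extensionality _ _ λ v →
    trans (lookup-zipWith _∨_ v (branches s) (branches t))
          (trans (cong₂ _∨_ (lookup-branches s v) (lookup-branches t v)) (sym (lookup-branches (λ c → s c ∨ t c) v)))

  branches-all : ∀ s → all s (allFin 4) ≡ true → branches s ≡ full
  branches-all s all-s = lookup-extensionality _ _ λ v →
    trans (lookup-branches s v) (trans (all-allFin⁻ {4} s all-s (branch v)) (sym (∈-full v)))

  fIn-branches-∪ : ∀ H s t {m} → fIn H (branches s ∪ branches t) ≡ m → fIn H (branches (λ c → s c ∨ t c)) ≡ m
  fIn-branches-∪ H s t = trans (cong (fIn H) (sym (branches-∪ s t)))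

  fAt-branches-∪ : ∀ H s t w {m} → fAt H (branches s ∪ branches t) w ≡ m → fAt H (branches (λ c → s c ∨ t c)) w ≡ m
  fAt-branches-∪ H s t w = trans (cong (λ Y → fAt H Y w) (sym (branches-∪ s t)))

  subtreesOf rootedAt : Fin 4 → ℕ
  subtreesOf c = fIn E (branches (only c))
  rootedAt c = fAt E (branches (only c)) (root c)

  module T-pq = BranchBridge E T-branch-edge E-edge-kinds sel₀ sel₁ (# 0) (# 1) refl refl refl refl pq
  module T-ur = BranchBridge E T-branch-edge E-edge-kinds sel₃ sel₂ (# 3) (# 2) refl refl refl refl (trans (adj-sym E u r) ru)
  module T-qr = BranchBridge E T-branch-edge E-edge-kinds sel₀₁ sel₃₂ (# 1) (# 2) refl refl refl refl qr

  f-T : f E ≡ (subtreesOf (# 0) + (subtreesOf (# 1) + rootedAt (# 0) * rootedAt (# 1)))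
            + ((subtreesOf (# 3) + (subtreesOf (# 2) + rootedAt (# 3) * rootedAt (# 2)))
               + (rootedAt (# 1) + rootedAt (# 0) * rootedAt (# 1)) * (rootedAt (# 2) + rootedAt (# 3) * rootedAt (# 2)))
  f-T = begin
    f E                                       ≡⟨ f≡fIn-full E ⟩
    fIn E full                                ≡⟨ cong (fIn E) covers ⟨
    fIn E (branches sel₀₁ ∪ branches sel₃₂)   ≡⟨ T-qr.fIn-bridge ⟩
    fIn E (branches sel₀₁) + (fIn E (branches sel₃₂) + fAt E (branches sel₀₁) q * fAt E (branches sel₃₂) r)
      ≡⟨ cong₂ _+_ (fIn-branches-∪ E sel₀ sel₁ T-pq.fIn-bridge)
                   (cong₂ _+_ (fIn-branches-∪ E sel₃ sel₂ T-ur.fIn-bridge)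
                              (cong₂ _*_ (fAt-branches-∪ E sel₀ sel₁ q T-pq.fAt-bridge)
                                         (fAt-branches-∪ E sel₃ sel₂ r T-ur.fAt-bridge))) ⟩
    _ ∎
    where
    open ≡-Reasoning
    covers : branches sel₀₁ ∪ branches sel₃₂ ≡ full
    covers = trans (branches-∪ sel₀₁ sel₃₂) (branches-all (λ c → sel₀₁ c ∨ sel₃₂ c) refl)

  pr∈S : adj S p r ≡ true
  pr∈S = ∨-introˡ (SameEdge⇒sameEdge {a = p} {b = r} (inj₁ (refl , refl)))

  uq∈S : adj S u q ≡ true
  uq∈S = ∨-introʳ {sameEdge (p , r) u q} (∨-introˡ (SameEdge⇒sameEdge {a = q} {b = u} (inj₂ (refl , refl))))

  rq∈S : adj S r q ≡ true
  rq∈S = ∨-introʳ {sameEdge (p , r) r q} (∨-introʳ {sameEdge (q , u) r q}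
    (adj-removeEdge⁺ E-ru p q r q (adj-removeEdge⁺ E r u r q (trans (adj-sym E r q) qr) (sameEdge-false-snd r q r u q≢r q≢u))
                     (sameEdge-false-fst r q p q (p≢r ∘ sym) (q≢r ∘ sym))))

  module S-pr = BranchBridge S S-branch-edge S-edge-kinds sel₀ sel₂ (# 0) (# 2) refl refl refl refl pr∈S
  module S-uq = BranchBridge S S-branch-edge S-edge-kinds sel₃ sel₁ (# 3) (# 1) refl refl refl refl uq∈S
  module S-rq = BranchBridge S S-branch-edge S-edge-kinds sel₀₂ sel₃₁ (# 2) (# 1) refl refl refl refl rq∈S

  S-agrees-on-branch : ∀ c → AgreeOn (branches (only c)) S E
  S-agrees-on-branch c a b a∈ b∈ = S-within-branch a b (same-branch-of-only c a b a∈ b∈)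

  subtreesOf-S : ∀ c → fIn S (branches (only c)) ≡ subtreesOf c
  subtreesOf-S c = fIn-local (branches (only c)) S E (S-agrees-on-branch c)

  rootedAt-S : ∀ c → fAt S (branches (only c)) (root c) ≡ rootedAt c
  rootedAt-S c = fAt-local (branches (only c)) S E (S-agrees-on-branch c) (root c)

  f-S : f S ≡ (subtreesOf (# 0) + (subtreesOf (# 2) + rootedAt (# 0) * rootedAt (# 2)))
            + ((subtreesOf (# 3) + (subtreesOf (# 1) + rootedAt (# 3) * rootedAt (# 1)))
               + (rootedAt (# 2) + rootedAt (# 0) * rootedAt (# 2)) * (rootedAt (# 1) + rootedAt (# 3) * rootedAt (# 1)))
  f-S = begin
    f S                                       ≡⟨ f≡fIn-full S ⟩
    fIn S full                                ≡⟨ cong (fIn S) covers ⟨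
    fIn S (branches sel₀₂ ∪ branches sel₃₁)   ≡⟨ S-rq.fIn-bridge ⟩
    fIn S (branches sel₀₂) + (fIn S (branches sel₃₁) + fAt S (branches sel₀₂) r * fAt S (branches sel₃₁) q)
      ≡⟨ cong₂ _+_ (fIn-branches-∪ S sel₀ sel₂ S-pr.fIn-bridge)
                   (cong₂ _+_ (fIn-branches-∪ S sel₃ sel₁ S-uq.fIn-bridge)
                              (cong₂ _*_ (fAt-branches-∪ S sel₀ sel₂ r S-pr.fAt-bridge)
                                         (fAt-branches-∪ S sel₃ sel₁ q S-uq.fAt-bridge))) ⟩
    (F₀ + (F₂ + R₀ * R₂)) + ((F₃ + (F₁ + R₃ * R₁)) + (R₂ + R₀ * R₂) * (R₁ + R₃ * R₁))
      ≡⟨ cong₂ _+_ (cong₂ _+_ (subtreesOf-S (# 0)) (cong₂ _+_ (subtreesOf-S (# 2)) (cong₂ _*_ (rootedAt-S (# 0)) (rootedAt-S (# 2)))))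
                   (cong₂ _+_ (cong₂ _+_ (subtreesOf-S (# 3)) (cong₂ _+_ (subtreesOf-S (# 1))
                                                                        (cong₂ _*_ (rootedAt-S (# 3)) (rootedAt-S (# 1)))))
                              (cong₂ _*_ (cong₂ _+_ (rootedAt-S (# 2)) (cong₂ _*_ (rootedAt-S (# 0)) (rootedAt-S (# 2))))
                                         (cong₂ _+_ (rootedAt-S (# 1)) (cong₂ _*_ (rootedAt-S (# 3)) (rootedAt-S (# 1)))))) ⟩
    _ ∎
    where
    open ≡-Reasoning
    covers : branches sel₀₂ ∪ branches sel₃₁ ≡ full
    covers = trans (branches-∪ sel₀₂ sel₃₁) (branches-all (λ c → sel₀₂ c ∨ sel₃₁ c) refl)
    F₀ F₁ F₂ F₃ R₀ R₁ R₂ R₃ : ℕ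
    F₀ = fIn S (branches sel₀)
    F₁ = fIn S (branches sel₁)
    F₂ = fIn S (branches sel₂)
    F₃ = fIn S (branches sel₃)
    R₀ = fAt S (branches sel₀) p
    R₁ = fAt S (branches sel₁) q
    R₂ = fAt S (branches sel₂) r
    R₃ = fAt S (branches sel₃) u

  Cle≡rootedAt : Cle E x i ≡ rootedAt (# 0)
  Cle≡rootedAt =
    trans (cong (λ Y → fAt E-pq Y p) (component-after-cut (# 0) (# 1) (λ ()) λ { (fsuc fzero) _ → refl }))
          (fAt-local (branches sel₀) E-pq E
            (λ a b a∈ b∈ → removeEdge-within-branch E (# 0) (# 1) (λ ()) a b (same-branch-of-only (# 0) a b a∈ b∈)) p)

  Cge≡rootedAt : Cge E x (suc (suc (suc i))) ≡ rootedAt (# 3)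
  Cge≡rootedAt =
    trans (cong (λ G → fAt G (component G u) u) (removeEdge-sym E r u))
          (trans (cong (λ Y → fAt E-ur Y u) (component-after-cut (# 3) (# 2) (λ ()) λ { (fsuc (fsuc fzero)) _ → refl }))
                 (fAt-local (branches sel₃) E-ur E
                   (λ a b a∈ b∈ → removeEdge-within-branch E (# 3) (# 2) (λ ()) a b (same-branch-of-only (# 3) a b a∈ b∈)) u))
    where
    E-ur : Graph N
    E-ur = removeEdge u r E

  fAt-removePath≡rootedAt : ∀ c → c ≢ # 0 → c ≢ # 3 → fAt D (component D (root c)) (root c) ≡ rootedAt c
  fAt-removePath≡rootedAt c ≢0 ≢3 =
    trans (cong (λ Y → fAt D Y (root c)) (component-removePath c ≢0 ≢3))
          (fAt-local (branches (only c)) D E (λ a b a∈ b∈ → D-within-middle-branch a b (same-branch-of-only c a b a∈ b∈)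
                                                             (≢0 ∘ trans (sym (∈-branches-only c a a∈)))
                                                             (≢3 ∘ trans (sym (∈-branches-only c a a∈)))) (root c))

  Cmid-q≡rootedAt : Cmid E n x (suc i) ≡ rootedAt (# 1)
  Cmid-q≡rootedAt = fAt-removePath≡rootedAt (# 1) (λ ()) (λ ())

  Cmid-r≡rootedAt : Cmid E n x (suc (suc i)) ≡ rootedAt (# 2)
  Cmid-r≡rootedAt = fAt-removePath≡rootedAt (# 2) (λ ()) (λ ())

-- With P₃ = P₀ + 1 + d and P₁ = P₂ + 1 + e the two sides differ by exactly (1 + d)(1 + e) = (P₃ − P₀)(P₁ − P₂).
swap-gain-identity : ∀ A₀ A₁ A₂ A₃ P₀ P₂ d e →
  (A₀ + (A₂ + P₀ * P₂)) + ((A₃ + (A₁ + (suc P₀ + d) * (suc P₂ + e)))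
                           + (P₂ + P₀ * P₂) * ((suc P₂ + e) + (suc P₀ + d) * (suc P₂ + e)))
  ≡ ((A₀ + (A₁ + P₀ * (suc P₂ + e))) + ((A₃ + (A₂ + (suc P₀ + d) * P₂))
                                        + ((suc P₂ + e) + P₀ * (suc P₂ + e)) * (P₂ + (suc P₀ + d) * P₂)))
    + suc d * suc e
swap-gain-identity = solve-∀

swap-gain : ∀ A₀ A₁ A₂ A₃ P₀ P₁ P₂ P₃ → P₀ < P₃ → P₂ < P₁ →
  (A₀ + (A₁ + P₀ * P₁)) + ((A₃ + (A₂ + P₃ * P₂)) + (P₁ + P₀ * P₁) * (P₂ + P₃ * P₂)) <
  (A₀ + (A₂ + P₀ * P₂)) + ((A₃ + (A₁ + P₃ * P₁)) + (P₂ + P₀ * P₂) * (P₁ + P₃ * P₁))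
swap-gain A₀ A₁ A₂ A₃ P₀ P₁ P₂ P₃ P₀<P₃ P₂<P₁ with m≤n⇒∃[o]m+o≡n P₀<P₃ | m≤n⇒∃[o]m+o≡n P₂<P₁
... | d , refl | e , refl =
  subst (before <_) (sym (swap-gain-identity A₀ A₁ A₂ A₃ P₀ P₂ d e)) (m<m+n before {suc d * suc e} (s≤s z≤n))
  where
  before : ℕ
  before = (A₀ + (A₁ + P₀ * (suc P₂ + e))) + ((A₃ + (A₂ + (suc P₀ + d) * P₂))
           + ((suc P₂ + e) + P₀ * (suc P₂ + e)) * (P₂ + (suc P₀ + d) * P₂))

lemma2p5 : (N : ℕ) (E : Graph N) → IsTree N E →
    (v₁ v₂ : Fin N) → v₁ ≢ v₂ → IsLeaf E v₁ → IsLeaf E v₂ →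
    (n : ℕ) (x : ℕ → Fin N) → x 0 ≡ v₁ → x (suc n) ≡ v₂ → IsPath E n x →
    (k : ℕ) → 1 ≤ k → k ≤ n ∸ 1 →
    Cle E x (k ∸ 1) < Cge E x (suc (suc k)) →
    Cmid E n x k > Cmid E n x (suc k) →
    f (swapTree E x k) > f E
lemma2p5 N E tree _ _ _ _ _ (suc m) x _ _ path (suc i) _ i+1≤m Cle<Cge Cmid>Cmid =
  subst₂ _<_ (sym f-T) (sym f-S)
    (swap-gain (subtreesOf (# 0)) (subtreesOf (# 1)) (subtreesOf (# 2)) (subtreesOf (# 3))
               (rootedAt (# 0)) (rootedAt (# 1)) (rootedAt (# 2)) (rootedAt (# 3))
               (subst₂ _<_ Cle≡rootedAt Cge≡rootedAt Cle<Cge)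
               (subst₂ _<_ Cmid-r≡rootedAt Cmid-q≡rootedAt Cmid>Cmid))
  where open Swap E tree (suc m) x path i (s≤s i+1≤m)
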